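{- Let $r\ge 3$ and $k\ge 0$ be integers, let $G$ be a $(K_{1,r};k)$-vertex stable graph of order $r+k+1$, and let $k_0=\min\{k' : k'>(r-1)^2-2 \text{ and } k' \text{ is odd}\}$. (1) If $r$ is odd, or $r$ is even and $k<(r-1)^2-2$, then $|E(G)|\ge \frac12(k+1)(2r+k)$, and the sole extremal graph is $G(r,k)$. (2) If $r$ is even and $k=(r-1)^2-2$, then $|E(G)|\ge \frac12(k+1)(2r+k)$ and there are exactly two extremal graphs: $G(r,k)$ and $K_{r+k+1}^{r+k-1}$. If $r$ is even and $k=(r-1)^2-1$, then $|E(G)|\ge \frac12(k+1)(2r+k)$ and there are exactly two extremal graphs: $G(r,k)$ and $K_{r+k}^{r+k-2}*K_1$. (3) If $r$ is even, $k$ is odd and $k\ge k_0$, then $|E(G)|\ge \frac12((r+k)^2-1)$ and the sole extremal graph is $K_{r+k+1}^{r+k-1}$. (4) If $r$ and $k$ are both even and $k\ge k_0$, then $|E(G)|\ge \frac12(r+k)^2$ and the sole extremal graph is $K_{r+k}^{r+k-2}*K_1$.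
   Context: Graphs are finite, undirected, simple. A graph $G$ is $(H;k)$-vertex stable if for every set $F$ of $k$ vertices of $G$, the graph $G-F$ (obtained by deleting the vertices of $F$ with their incident edges) contains a subgraph isomorphic to $H$. $K_{1,r}$ is the star with one center and $r\ge 3$ leaves. An extremal graph (in each case) means a $(K_{1,r};k)$-vertex stable graph of order $r+k+1$ whose number of edges equals the stated lower bound; "sole"/"exactly two" is up to isomorphism. $G(r,k)$ denotes $K_{k+1}*\overline{K}_r$: a clique on $k+1$ vertices, an independent set of $r$ vertices, and all edges between the two sets. For graphs $G_1,G_2$ on disjoint vertex sets, $G_1*G_2$ has vertex set $V(G_1)\cup V(G_2)$ and edge set $E(G_1)\cup E(G_2)$ plus all edges between $V(G_1)$ and $V(G_2)$. For even $n$, $K_n^{n-2}$ is the $(n-2)$-regular graph of order $n$ (complete graph $K_n$ minus a perfect matching). $K_{r+k}^{r+k-2}*K_1$ is thus $K_{r+k}^{r+k-2}$ with one additional vertex adjacent to all other vertices. -}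

module Defs where

open import Data.Nat using (ℕ; zero; suc; _+_; _*_; _∸_; _^_; _≤_; _<_; _≡ᵇ_; _<ᵇ_; _/_; _%_)
open import Data.Bool using (Bool; true; false; not; _∧_; _∨_; if_then_else_)
open import Data.Bool.Properties using (∨-comm)
open import Data.Fin using (Fin; toℕ)
open import Data.Fin.Subset using (Subset; ∣_∣; _∉_)
open import Data.Fin.Permutation using (Permutation′; _⟨$⟩ʳ_)
open import Data.List using (List; map; allFin)
open import Data.Nat.ListAction using (sum)
open import Data.Product using (Σ; ∃; _×_; _,_)
open import Data.Sum using (_⊎_)
open import Function.Definitions using (Injective)
open import Relation.Nullary using (¬_)
open import Relation.Binary.PropositionalEquality using (_≡_; refl; cong; cong₂)

record Graph (n : ℕ) : Set where
  field
    Adj    : Fin n → Fin n → Bool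
    sym    : ∀ i j → Adj i j ≡ Adj j i
    irrefl : ∀ i → Adj i i ≡ false
open Graph public

edges : ∀ {n} → Graph n → ℕ
edges {n} G =
  sum (map (λ i → sum (map (λ j →
         if (toℕ i <ᵇ toℕ j) ∧ Adj G i j then 1 else 0) (allFin n))) (allFin n))

_≅_ : ∀ {n} → Graph n → Graph n → Set
_≅_ {n} G H = Σ (Permutation′ n) λ π →
  ∀ i j → Adj G i j ≡ Adj H (π ⟨$⟩ʳ i) (π ⟨$⟩ʳ j)

-- G contains a subgraph isomorphic to K_{1,r} avoiding the vertex set F:
-- a centre c ∉ F and r distinct leaves ∉ F, each adjacent to c
-- (leaves differ from c automatically since G is loopless)
HasStarAvoiding : ∀ {n} → ℕ → Graph n → Subset n → Set
HasStarAvoiding {n} r G F =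
  Σ (Fin n) λ c → c ∉ F × Σ (Fin r → Fin n) λ leaf →
    Injective _≡_ _≡_ leaf × (∀ l → leaf l ∉ F × Adj G c (leaf l) ≡ true)

VertexStable : ∀ {n} → ℕ → ℕ → Graph n → Set
VertexStable {n} r k G = (F : Subset n) → ∣ F ∣ ≡ k → HasStarAvoiding r G F

≡ᵇ-sym : ∀ a b → (a ≡ᵇ b) ≡ (b ≡ᵇ a)
≡ᵇ-sym zero zero = refl
≡ᵇ-sym zero (suc b) = refl
≡ᵇ-sym (suc a) zero = refl
≡ᵇ-sym (suc a) (suc b) = ≡ᵇ-sym a b

≡ᵇ-refl : ∀ a → (a ≡ᵇ a) ≡ true
≡ᵇ-refl zero = refl
≡ᵇ-refl (suc a) = ≡ᵇ-refl a

-- G(r,k) = K_{k+1} * complement(K_r), on Fin (r + k + 1):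
-- vertices with index < k+1 form the clique, the others the independent set

GRK : (r k : ℕ) → Graph (r + k + 1)
GRK r k = record
  { Adj    = λ i j → not (toℕ i ≡ᵇ toℕ j) ∧ (inK i ∨ inK j)
  ; sym    = λ i j → cong₂ _∧_ (cong not (≡ᵇ-sym (toℕ i) (toℕ j))) (∨-comm (inK i) (inK j))
  ; irrefl = λ i → cong (λ b → not b ∧ (inK i ∨ inK i)) (≡ᵇ-refl (toℕ i))
  }
  where
  inK : Fin (r + k + 1) → Bool
  inK i = toℕ i <ᵇ suc k

-- For n even this is K_n^{n-2} (K_n minus a perfect matching).
-- For n odd the last vertex n-1 is unmatched, hence adjacent to all others,
-- and the graph is K_{n-1}^{n-3} * K_1.
KminusM : (n : ℕ) → Graph n
KminusM n = record
  { Adj    = λ i j → not (toℕ i / 2 ≡ᵇ toℕ j / 2)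
  ; sym    = λ i j → cong not (≡ᵇ-sym (toℕ i / 2) (toℕ j / 2))
  ; irrefl = λ i → cong not (≡ᵇ-refl (toℕ i / 2))
  }

-- extremality notions, for graphs of order r + k + 1.
-- "bound2" is twice the lower bound on |E(G)| (all bounds are integers).

LowerBound : (r k bound2 : ℕ) → Set
LowerBound r k bound2 =
  (G : Graph (r + k + 1)) → VertexStable r k G → bound2 ≤ 2 * edges G

Extremal : (r k bound2 : ℕ) → Graph (r + k + 1) → Set
Extremal r k bound2 G = VertexStable r k G × 2 * edges G ≡ bound2

SoleExtremal : (r k bound2 : ℕ) → Graph (r + k + 1) → Set
SoleExtremal r k bound2 H =
  Extremal r k bound2 H × (∀ G → Extremal r k bound2 G → G ≅ H)

TwoExtremal : (r k bound2 : ℕ) → Graph (r + k + 1) → Graph (r + k + 1) → Set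
TwoExtremal r k bound2 H₁ H₂ =
  Extremal r k bound2 H₁ × Extremal r k bound2 H₂ × ¬ (H₁ ≅ H₂) ×
  (∀ G → Extremal r k bound2 G → G ≅ H₁ ⊎ G ≅ H₂)

Odd : ℕ → Set
Odd n = n % 2 ≡ 1

Even : ℕ → Set
Even n = n % 2 ≡ 0

IsK₀ : (r k₀ : ℕ) → Set
IsK₀ r k₀ = Odd k₀ × (r ∸ 1) ^ 2 ∸ 2 < k₀ ×
            (∀ k' → Odd k' → (r ∸ 1) ^ 2 ∸ 2 < k' → k₀ ≤ k')

-- twice the bound (1/2)(k+1)(2r+k)
boundGRK : ℕ → ℕ → ℕ
boundGRK r k = (k + 1) * (2 * r + k)

{-# OPTIONS --safe #-}
-- Write h(x) for the number of non-neighbours of x and H for the sum of all h(x); counting pairs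
-- gives 2|E| + H + n = n², so lower bounds on |E| are upper bounds on H. A set S of r + 1 vertices
-- in which every vertex has a non-neighbour is fatal to stability: delete the k vertices outside
-- S, and no surviving centre sees the r others. Let W be the set of deficient vertices, those
-- with h(x) > 0. If some vertex has two non-neighbours, such sets can be grown inside W, two
-- vertices at a time plus one spare vertex, to every size from 3 to |W|; hence |W| ≤ r and
-- H ≤ |W|(|W| - 1) ≤ r(r - 1), with equality only for G(r,k). Otherwise the non-edges form a
-- matching, H = |W| ≤ n is even, and such sets exist in every even size up to |W|, so |W| ≤ r
-- when r is odd. Comparing r(r - 1) with n and n - 1 separates the regimes; complete graphs minus
-- a (near-)perfect matching attain H = n and H = n - 1.
module Submission where

open import Defs hiding (sym)
open import Data.Bool using (Bool; true; false; not; _∧_; _∨_; if_then_else_; T)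
open import Data.Bool.Properties using (∧-zeroʳ; ∧-identityʳ; ∨-identityʳ)
open import Data.Empty using (⊥; ⊥-elim)
open import Data.Fin using (Fin; zero; suc; toℕ; fromℕ<; punchIn; punchOut; _≟_)
open import Data.Fin.Permutation using (Permutation′; _⟨$⟩ʳ_; _⟨$⟩ˡ_; insert; lift₀; insert-punchIn; inverseˡ)
import Data.Fin.Permutation as Perm
open import Data.Fin.Properties
  using (toℕ-injective; toℕ<n; toℕ-fromℕ<; punchInᵢ≢i; punchIn-injective; punchIn-punchOut)
import Data.Fin.Properties as Fin
open import Data.Fin.Subset using (Subset; ∣_∣; _∉_)
open import Data.List as List using (allFin)
open import Data.Nat using (ℕ; zero; suc; _+_; _*_; _∸_; _^_; _≤_; _<_; z≤n; s≤s; _≡ᵇ_; _<ᵇ_; _/_; _%_; _≤?_; ⌊_/2⌋)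
open import Data.Nat.DivMod using (m≡m%n+[m/n]*n; m/n≡1+[m∸n]/n)
import Data.Nat.ListAction as ListAction
open import Data.Nat.Properties hiding (_≟_)
open import Data.Nat.Tactic.RingSolver using (solve-∀)
open import Algebra.Properties.Semiring.Sum +-*-semiring
  using (sum; sum-cong-≗; ∑-distrib-+; ∑-comm; sum-remove; *-distribʳ-sum)
open import Data.Product using (Σ; _×_; _,_; proj₁; proj₂)
open import Data.Sum using (_⊎_; inj₁; inj₂)
open import Data.Vec using ([]; _∷_; lookup; tabulate)
open import Data.Vec.Properties using ([]=⇒lookup; lookup⇒[]=; lookup∘tabulate)
open import Function.Definitions using (Injective)
open import Relation.Binary.PropositionalEquality
open import Relation.Nullary using (¬_; yes; no)

-- Counting over a finite vertex set

t≢f : true ≢ false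
t≢f ()

not-true : ∀ {b} → not b ≡ true → b ≡ false
not-true {false} _ = refl

not-false : ∀ {b} → not b ≡ false → b ≡ true
not-false {true} _ = refl

∧-trueˡ : ∀ {a b} → (a ∧ b) ≡ true → a ≡ true
∧-trueˡ {true} _ = refl

∧-trueʳ : ∀ {a b} → (a ∧ b) ≡ true → b ≡ true
∧-trueʳ {true} e = e

∧-true : ∀ {a b} → a ≡ true → b ≡ true → (a ∧ b) ≡ true
∧-true refl refl = refl

∧-falseʳ : ∀ {a b} → (a ∧ b) ≡ false → a ≡ true → b ≡ false
∧-falseʳ {true} e _ = e

∧-falseˡ : ∀ {a b} → (a ∧ b) ≡ false → b ≡ true → a ≡ false
∧-falseˡ {false} _ _ = refl
∧-falseˡ {true} e refl = e

∨-true : ∀ {a b} → (a ∨ b) ≡ true → a ≡ true ⊎ b ≡ true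
∨-true {true} _ = inj₁ refl
∨-true {false} e = inj₂ e

∨-trueˡ : ∀ {a} b → a ≡ true → (a ∨ b) ≡ true
∨-trueˡ b refl = refl

∨-trueʳ : ∀ a {b} → b ≡ true → (a ∨ b) ≡ true
∨-trueʳ true _ = refl
∨-trueʳ false e = e

∨-false : ∀ {a b} → a ≡ false → b ≡ false → (a ∨ b) ≡ false
∨-false refl refl = refl

T⇒true : ∀ {b} → T b → b ≡ true
T⇒true {true} _ = refl

true⇒T : ∀ {b} → b ≡ true → T b
true⇒T refl = _

-- The Boolean vertex test used by the adjacency of GRK and KminusM, so that those compute.
_==_ : ∀ {n} → Fin n → Fin n → Bool
i == j = toℕ i ≡ᵇ toℕ j

==⇒≡ : ∀ {n} {i j : Fin n} → (i == j) ≡ true → i ≡ j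
==⇒≡ {i = i} {j} e = toℕ-injective (≡ᵇ⇒≡ (toℕ i) (toℕ j) (true⇒T e))

==-refl : ∀ {n} (i : Fin n) → (i == i) ≡ true
==-refl i = T⇒true (≡⇒≡ᵇ (toℕ i) (toℕ i) refl)

≢⇒≡ᵇ-false : ∀ {a b} → a ≢ b → (a ≡ᵇ b) ≡ false
≢⇒≡ᵇ-false {a} {b} a≢b with a ≡ᵇ b in e
... | false = refl
... | true = ⊥-elim (a≢b (≡ᵇ⇒≡ a b (true⇒T e)))

≢⇒==false : ∀ {n} {i j : Fin n} → i ≢ j → (i == j) ≡ false
≢⇒==false i≢j = ≢⇒≡ᵇ-false (λ e → i≢j (toℕ-injective e))

==false⇒≢ : ∀ {n} {i j : Fin n} → (i == j) ≡ false → i ≢ j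
==false⇒≢ {i = i} e refl = t≢f (trans (sym (==-refl i)) e)

==-sym : ∀ {n} (i j : Fin n) → (i == j) ≡ (j == i)
==-sym i j = ≡ᵇ-sym (toℕ i) (toℕ j)

<ᵇ-suc : ∀ a t → (a <ᵇ suc t) ≡ true → (a <ᵇ t) ≡ true ⊎ a ≡ t
<ᵇ-suc zero    zero    _ = inj₂ refl
<ᵇ-suc zero    (suc t) _ = inj₁ refl
<ᵇ-suc (suc a) (suc t) e with <ᵇ-suc a t e
... | inj₁ a<t = inj₁ a<t
... | inj₂ a≡t = inj₂ (cong suc a≡t)

<ᵇ-weaken : ∀ a t → (a <ᵇ t) ≡ true → (a <ᵇ suc t) ≡ true
<ᵇ-weaken zero    t       _ = refl
<ᵇ-weaken (suc a) (suc t) e = <ᵇ-weaken a t e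

<ᵇ-zero : ∀ a → (a <ᵇ 0) ≡ false
<ᵇ-zero zero    = refl
<ᵇ-zero (suc a) = refl

<⇒<ᵇ-true : ∀ {a t} → a < t → (a <ᵇ t) ≡ true
<⇒<ᵇ-true a<t = T⇒true (<⇒<ᵇ a<t)

sum-const : ∀ n c → sum {n} (λ _ → c) ≡ n * c
sum-const zero c = refl
sum-const (suc n) c = cong (c +_) (sum-const n c)

sum-mono : ∀ {n} {f g : Fin n → ℕ} → (∀ i → f i ≤ g i) → sum f ≤ sum g
sum-mono {zero} f≤g = z≤n
sum-mono {suc n} f≤g = +-mono-≤ (f≤g zero) (sum-mono (λ i → f≤g (suc i)))

sum-mono-tight : ∀ {n} {f g : Fin n → ℕ} → (∀ i → f i ≤ g i) → sum f ≡ sum g → ∀ i → f i ≡ g i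
sum-mono-tight {suc n} {f} {g} f≤g Σf≡Σg i with m≤n⇒m<n∨m≡n (f≤g zero)
... | inj₁ f₀<g₀ = ⊥-elim (<-irrefl Σf≡Σg (+-mono-<-≤ f₀<g₀ (sum-mono (λ i → f≤g (suc i)))))
... | inj₂ f₀≡g₀ with i
...   | zero = f₀≡g₀
...   | suc i = sum-mono-tight (λ i → f≤g (suc i))
                  (+-cancelˡ-≡ (f zero) _ _ (trans Σf≡Σg (cong (_+ _) (sym f₀≡g₀)))) i

sum-tabulate : ∀ {m} {A : Set} (f : A → ℕ) (g : Fin m → A) →
  ListAction.sum (List.map f (List.tabulate g)) ≡ sum (λ i → f (g i))
sum-tabulate {zero} f g = refl
sum-tabulate {suc m} f g = cong (f (g zero) +_) (sum-tabulate f (λ i → g (suc i)))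

fromBool : Bool → ℕ
fromBool b = if b then 1 else 0

count : ∀ {n} → (Fin n → Bool) → ℕ
count P = sum (λ i → fromBool (P i))

count-cong : ∀ {n} {P Q : Fin n → Bool} → (∀ i → P i ≡ Q i) → count P ≡ count Q
count-cong P≗Q = sum-cong-≗ (λ i → cong fromBool (P≗Q i))

count-true : ∀ n → count {n} (λ _ → true) ≡ n
count-true n = trans (sum-const n 1) (*-identityʳ n)

count-false : ∀ {n} {P : Fin n → Bool} → (∀ i → P i ≡ false) → count P ≡ 0
count-false {n} P≗false = trans (count-cong P≗false) (trans (sum-const n 0) (*-zeroʳ n))

fromBool-mono : ∀ {a b} → (a ≡ true → b ≡ true) → fromBool a ≤ fromBool b
fromBool-mono {false} a⇒b = z≤n
fromBool-mono {true} a⇒b rewrite a⇒b refl = ≤-refl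

count-mono : ∀ {n} {P Q : Fin n → Bool} → (∀ i → P i ≡ true → Q i ≡ true) → count P ≤ count Q
count-mono P⊆Q = sum-mono (λ i → fromBool-mono (P⊆Q i))

count≤n : ∀ {n} (P : Fin n → Bool) → count P ≤ n
count≤n {n} P = ≤-trans (count-mono {P = P} {Q = λ _ → true} (λ _ _ → refl)) (≤-reflexive (count-true n))

count-mono-tight : ∀ {n} {P Q : Fin n → Bool} → (∀ i → P i ≡ true → Q i ≡ true) →
  count P ≡ count Q → ∀ i → Q i ≡ true → P i ≡ true
count-mono-tight {P = P} {Q} P⊆Q eq i Qi = lemma (P i) (Q i) (sum-mono-tight (λ j → fromBool-mono (P⊆Q j)) eq i) Qi
  where
  lemma : ∀ a b → fromBool a ≡ fromBool b → b ≡ true → a ≡ true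
  lemma true  _     _  _ = refl
  lemma false true  () _
  lemma false false _  ()

count-∧-split : ∀ {n} (P Q : Fin n → Bool) →
  count P ≡ count (λ i → P i ∧ Q i) + count (λ i → P i ∧ not (Q i))
count-∧-split P Q = trans (sum-cong-≗ (λ i → split (P i) (Q i)))
  (∑-distrib-+ (λ i → fromBool (P i ∧ Q i)) (λ i → fromBool (P i ∧ not (Q i))))
  where
  split : ∀ a b → fromBool a ≡ fromBool (a ∧ b) + fromBool (a ∧ not b)
  split true  true  = refl
  split true  false = refl
  split false b     = refl

count-not : ∀ {n} (P : Fin n → Bool) → count P + count (λ i → not (P i)) ≡ n
count-not {n} P = trans (sym (∑-distrib-+ (λ i → fromBool (P i)) (λ i → fromBool (not (P i))))) (trans (sum-cong-≗ (λ i → total (P i))) (count-true n))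
  where
  total : ∀ b → fromBool b + fromBool (not b) ≡ 1
  total true  = refl
  total false = refl

count-∨ : ∀ {n} (P Q : Fin n → Bool) → count (λ i → P i ∨ Q i) ≤ count P + count Q
count-∨ P Q = ≤-trans (sum-mono (λ i → sub (P i) (Q i))) (≤-reflexive (∑-distrib-+ (λ i → fromBool (P i)) (λ i → fromBool (Q i))))
  where
  sub : ∀ a b → fromBool (a ∨ b) ≤ fromBool a + fromBool b
  sub true  b = s≤s z≤n
  sub false b = ≤-refl

count-∨-disjoint : ∀ {n} (P Q : Fin n → Bool) → (∀ i → P i ≡ true → Q i ≡ false) →
  count (λ i → P i ∨ Q i) ≡ count P + count Q
count-∨-disjoint P Q disj = trans (sum-cong-≗ (λ i → add (P i) (Q i) (disj i)))
  (∑-distrib-+ (λ i → fromBool (P i)) (λ i → fromBool (Q i)))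
  where
  add : ∀ a b → (a ≡ true → b ≡ false) → fromBool (a ∨ b) ≡ fromBool a + fromBool b
  add true  b a⇒¬b rewrite a⇒¬b refl = refl
  add false b _ = refl

count-singleton : ∀ {n} (a : Fin n) → count (a ==_) ≡ 1
count-singleton {suc n} a = trans (sum-remove {i = a} (λ i → fromBool (a == i)))
  (cong₂ _+_ (cong fromBool (==-refl a)) (count-false (λ i → ≢⇒==false (λ e → punchInᵢ≢i a i (sym e)))))

find : ∀ {n} (P : Fin n → Bool) → (Σ (Fin n) λ i → P i ≡ true) ⊎ (∀ i → P i ≡ false)
find {zero} P = inj₂ (λ ())
find {suc n} P with P zero in P₀
... | true = inj₁ (zero , P₀)
... | false with find (λ i → P (suc i))
...   | inj₁ (i , Pi) = inj₁ (suc i , Pi)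
...   | inj₂ none = inj₂ λ { zero → P₀ ; (suc i) → none i }

count-witness : ∀ {n} {P : Fin n → Bool} → 0 < count P → Σ (Fin n) λ i → P i ≡ true
count-witness {P = P} pos with find P
... | inj₁ w = w
... | inj₂ none = ⊥-elim (<-irrefl (sym (count-false none)) pos)

count-remove : ∀ {n} {P : Fin n → Bool} (a : Fin n) → P a ≡ true →
  count P ≡ suc (count (λ i → P i ∧ not (a == i)))
count-remove {P = P} a Pa = trans (count-∧-split P (a ==_))
  (cong (_+ count (λ i → P i ∧ not (a == i))) (trans (count-cong at-a) (count-singleton a)))
  where
  at-a : ∀ i → (P i ∧ (a == i)) ≡ (a == i)
  at-a i with a == i in e
  ... | false = ∧-zeroʳ (P i)
  ... | true = cong (_∧ true) (trans (cong P (sym (==⇒≡ e))) Pa)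

count-pos : ∀ {n} {P : Fin n → Bool} a → P a ≡ true → 1 ≤ count P
count-pos a Pa = subst (1 ≤_) (sym (count-remove a Pa)) (s≤s z≤n)

count-zero : ∀ {n} {P : Fin n → Bool} → count P ≡ 0 → ∀ i → P i ≡ false
count-zero {P = P} c≡0 i with P i in Pi
... | false = refl
... | true = ⊥-elim (<-irrefl refl (≤-trans (count-pos {P = P} i Pi) (≤-reflexive c≡0)))

count≤1 : ∀ {n} {P : Fin n → Bool} → (∀ i j → P i ≡ true → P j ≡ true → i ≡ j) → count P ≤ 1
count≤1 {P = P} unique with find P
... | inj₂ none = ≤-trans (≤-reflexive (count-false none)) z≤n
... | inj₁ (a , Pa) = ≤-trans (count-mono {Q = a ==_} (λ i Pi → subst (λ x → (a == x) ≡ true) (unique a i Pa Pi) (==-refl a)))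
                              (≤-reflexive (count-singleton a))

count-all : ∀ {n} {P : Fin n → Bool} → count P ≡ n → ∀ i → P i ≡ true
count-all {n} {P} ∣P∣≡n i = count-mono-tight {P = P} {Q = λ _ → true} (λ _ _ → refl) (trans ∣P∣≡n (sym (count-true n))) i refl

count-all-but-one : ∀ {n} {P : Fin n → Bool} → count (λ i → not (P i)) ≡ 1 →
  Σ (Fin n) λ u → P u ≡ false × (∀ i → i ≢ u → P i ≡ true)
count-all-but-one {P = P} one with count-witness {P = λ i → not (P i)} (≤-reflexive (sym one))
... | u , ¬Pu = u , not-true ¬Pu , λ i i≢u →
  not-false (∧-falseˡ (count-zero {P = λ i → not (P i) ∧ not (u == i)}
                          (suc-injective (trans (sym (count-remove {P = λ i → not (P i)} u ¬Pu)) one)) i)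
                      (cong not (≢⇒==false (λ u≡i → i≢u (sym u≡i)))))

count-initial-segment : ∀ n c → c ≤ n → count {n} (λ i → toℕ i <ᵇ c) ≡ c
count-initial-segment zero    zero    _ = refl
count-initial-segment (suc n) zero    _ = count-false {suc n} {λ i → toℕ i <ᵇ 0} (λ i → <ᵇ-zero (toℕ i))
count-initial-segment (suc n) (suc c) (s≤s c≤n) = cong suc (count-initial-segment n c c≤n)

two-witnesses : ∀ {n} (P : Fin n → Bool) → 2 ≤ count P →
  Σ (Fin n) λ a → Σ (Fin n) λ b → P a ≡ true × P b ≡ true × a ≢ b
two-witnesses P 2≤ with count-witness {P = P} (≤-trans (s≤s z≤n) 2≤)
... | a , Pa with count-witness {P = λ i → P i ∧ not (a == i)} (≤-pred (subst (2 ≤_) (count-remove a Pa) 2≤))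
...   | b , Pb = a , b , Pa , ∧-trueˡ Pb , λ { refl → t≢f (trans (sym (==-refl a)) (not-true (∧-trueʳ {P b} Pb))) }

enumerate : ∀ {n} (P : Fin n → Bool) r → r ≤ count P →
  Σ (Fin r → Fin n) λ f → Injective _≡_ _≡_ f × (∀ l → P (f l) ≡ true)
enumerate {zero} P zero _ = (λ ()) , (λ { {()} }) , (λ ())
enumerate {suc n} P r r≤ with P zero in P₀
enumerate {suc n} P zero _ | true = (λ ()) , (λ { {()} }) , (λ ())
enumerate {suc n} P (suc r) (s≤s r≤) | true with enumerate (λ i → P (suc i)) r r≤
... | g , g-inj , Pg = f , f-inj , Pf
  where
  f : Fin (suc r) → Fin (suc n)
  f zero = zero
  f (suc l) = suc (g l)
  f-inj : Injective _≡_ _≡_ f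
  f-inj {zero} {zero} _ = refl
  f-inj {suc x} {suc y} e = cong suc (g-inj (Fin.suc-injective e))
  Pf : ∀ l → P (f l) ≡ true
  Pf zero = P₀
  Pf (suc l) = Pg l
enumerate {suc n} P r r≤ | false with enumerate (λ i → P (suc i)) r r≤
... | g , g-inj , Pg = (λ l → suc (g l)) , (λ e → g-inj (Fin.suc-injective e)) , Pg

injection-count : ∀ {n} r (P : Fin n → Bool) (f : Fin r → Fin n) → Injective _≡_ _≡_ f →
  (∀ l → P (f l) ≡ true) → r ≤ count P
injection-count zero P f f-inj Pf = z≤n
injection-count (suc r) P f f-inj Pf = subst (suc r ≤_) (sym (count-remove (f zero) (Pf zero)))
  (s≤s (injection-count r _ (λ l → f (suc l)) (λ e → Fin.suc-injective (f-inj e)) λ l →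
     ∧-true (Pf (suc l)) (cong not (≢⇒==false (λ e → zero≢suc (f-inj e))))))
  where
  zero≢suc : ∀ {m} {l : Fin m} → zero ≢ suc l
  zero≢suc ()

anyᵇ : ∀ {n} → (Fin n → Bool) → Bool
anyᵇ {zero} P = false
anyᵇ {suc n} P = P zero ∨ anyᵇ (λ i → P (suc i))

anyᵇ-witness : ∀ {n} {P : Fin n → Bool} → anyᵇ P ≡ true → Σ (Fin n) λ i → P i ≡ true
anyᵇ-witness {suc n} {P} e with P zero in P₀
... | true = zero , P₀
... | false with anyᵇ-witness {P = λ i → P (suc i)} e
...   | i , Pi = suc i , Pi

anyᵇ-intro : ∀ {n} {P : Fin n → Bool} (i : Fin n) → P i ≡ true → anyᵇ P ≡ true
anyᵇ-intro {P = P} zero e = ∨-trueˡ _ e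
anyᵇ-intro {P = P} (suc i) e = ∨-trueʳ (P zero) (anyᵇ-intro {P = λ j → P (suc j)} i e)

anyᵇ-none : ∀ {n} {P : Fin n → Bool} → (∀ i → P i ≡ false) → anyᵇ P ≡ false
anyᵇ-none {zero} _ = refl
anyᵇ-none {suc n} none = ∨-false (none zero) (anyᵇ-none (λ i → none (suc i)))

anyᵇ-false : ∀ {n} {P : Fin n → Bool} → anyᵇ P ≡ false → ∀ i → P i ≡ false
anyᵇ-false {P = P} e i with P i in Pi
... | false = refl
... | true = ⊥-elim (t≢f (trans (sym (anyᵇ-intro i Pi)) e))

allᵇ : ∀ {n} → (Fin n → Bool) → Bool
allᵇ {zero} P = true
allᵇ {suc n} P = P zero ∧ allᵇ (λ i → P (suc i))

allᵇ-elim : ∀ {n} {P : Fin n → Bool} → allᵇ P ≡ true → ∀ i → P i ≡ true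
allᵇ-elim e zero = ∧-trueˡ e
allᵇ-elim {P = P} e (suc i) = allᵇ-elim {P = λ j → P (suc j)} (∧-trueʳ {P zero} e) i

allᵇ-counterexample : ∀ {n} {P : Fin n → Bool} → allᵇ P ≡ false → Σ (Fin n) λ i → P i ≡ false
allᵇ-counterexample {suc n} {P} e with P zero in P₀
... | false = zero , P₀
... | true with allᵇ-counterexample {P = λ i → P (suc i)} e
...   | i , Pi = suc i , Pi

choose : ∀ {n} → (Fin n → Bool) → Fin n → Fin n
choose P default with find P
... | inj₁ (i , _) = i
... | inj₂ _ = default

choose-spec : ∀ {n} (P : Fin n → Bool) default (i : Fin n) → P i ≡ true → P (choose P default) ≡ true
choose-spec P default i Pi with find P
... | inj₁ (_ , Pj) = Pj
... | inj₂ none = ⊥-elim (t≢f (trans (sym Pi) (none i)))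

count-lookup : ∀ {n} (F : Subset n) → ∣ F ∣ ≡ count (lookup F)
count-lookup [] = refl
count-lookup (true ∷ F) = cong suc (count-lookup F)
count-lookup (false ∷ F) = count-lookup F

lookup-false⇒∉ : ∀ {n} {x : Fin n} (F : Subset n) → lookup F x ≡ false → x ∉ F
lookup-false⇒∉ F e x∈F = t≢f (trans (sym ([]=⇒lookup x∈F)) e)

∉⇒lookup-false : ∀ {n} {x : Fin n} {F : Subset n} → x ∉ F → lookup F x ≡ false
∉⇒lookup-false {x = x} {F} x∉F with lookup F x in e
... | true = ⊥-elim (x∉F (lookup⇒[]= x F e))
... | false = refl

count-outside : ∀ r k (F : Subset (r + k + 1)) → ∣ F ∣ ≡ k → count (λ i → not (lookup F i)) ≡ suc r
count-outside r k F ∣F∣≡k = +-cancelˡ-≡ k _ _ (begin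
    k + count (λ i → not (lookup F i))                    ≡⟨ cong (_+ count (λ i → not (lookup F i))) (trans (sym ∣F∣≡k) (count-lookup F)) ⟩
    count (lookup F) + count (λ i → not (lookup F i))     ≡⟨ count-not (lookup F) ⟩
    r + k + 1                                             ≡⟨ trans (cong (_+ 1) (+-comm r k)) (trans (+-assoc k r 1) (cong (k +_) (+-comm r 1))) ⟩
    k + suc r                                             ∎)
  where open ≡-Reasoning

-- Non-neighbours and the handshake identity

NonAdj : ∀ {n} → Graph n → Fin n → Fin n → Bool
NonAdj G i j = not (Adj G i j) ∧ not (i == j)

degree : ∀ {n} → Graph n → Fin n → ℕ
degree G i = count (Adj G i)

nonDegree : ∀ {n} → Graph n → Fin n → ℕ
nonDegree G i = count (NonAdj G i)

NonAdj-sym : ∀ {n} (G : Graph n) i j → NonAdj G i j ≡ NonAdj G j i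
NonAdj-sym G i j = cong₂ (λ a b → not a ∧ not b) (Graph.sym G i j) (==-sym i j)

NonAdj-irrefl : ∀ {n} (G : Graph n) x → NonAdj G x x ≡ false
NonAdj-irrefl G x rewrite ==-refl x = ∧-zeroʳ (not (Adj G x x))

NonAdj⇒≢ : ∀ {n} (G : Graph n) {x y} → NonAdj G x y ≡ true → x ≢ y
NonAdj⇒≢ G {x} e refl = t≢f (trans (sym e) (NonAdj-irrefl G x))

NonAdj⇒¬Adj : ∀ {n} (G : Graph n) {x y} → NonAdj G x y ≡ true → Adj G x y ≡ false
NonAdj⇒¬Adj G e = not-true (∧-trueˡ e)

Adj⇒≢ : ∀ {n} (G : Graph n) {x y} → Adj G x y ≡ true → x ≢ y
Adj⇒≢ G {x} a refl = t≢f (trans (sym a) (irrefl G x))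

¬NonAdj⇒Adj : ∀ {n} (G : Graph n) {i j} → i ≢ j → NonAdj G i j ≡ false → Adj G i j ≡ true
¬NonAdj⇒Adj G {i} {j} i≢j e = lemma (Adj G i j) (i == j) e (≢⇒==false i≢j)
  where
  lemma : ∀ a b → (not a ∧ not b) ≡ false → b ≡ false → a ≡ true
  lemma true  b     _  _ = refl
  lemma false false () _

degree+nonDegree : ∀ {n} (G : Graph n) i → degree G i + nonDegree G i + 1 ≡ n
degree+nonDegree {n} G i = begin
    degree G i + nonDegree G i + 1
      ≡⟨ cong (degree G i + nonDegree G i +_) (sym (count-singleton i)) ⟩
    count (Adj G i) + count (NonAdj G i) + count (i ==_)
      ≡⟨ cong (_+ count (i ==_)) (sym (∑-distrib-+ (λ j → fromBool (Adj G i j)) (λ j → fromBool (NonAdj G i j)))) ⟩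
    sum (λ j → fromBool (Adj G i j) + fromBool (NonAdj G i j)) + count (i ==_)
      ≡⟨ sym (∑-distrib-+ (λ j → fromBool (Adj G i j) + fromBool (NonAdj G i j)) (λ j → fromBool (i == j))) ⟩
    sum (λ j → fromBool (Adj G i j) + fromBool (NonAdj G i j) + fromBool (i == j))
      ≡⟨ sum-cong-≗ (λ j → trichotomy (Adj G i j) (i == j) (λ e → subst (λ x → Adj G i x ≡ false) (==⇒≡ e) (irrefl G i))) ⟩
    count {n} (λ _ → true)
      ≡⟨ count-true n ⟩
    n ∎
  where
  open ≡-Reasoning
  trichotomy : ∀ a e → (e ≡ true → a ≡ false) → fromBool a + fromBool (not a ∧ not e) + fromBool e ≡ 1
  trichotomy true  false _ = refl
  trichotomy true  true  h with h refl
  ... | ()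
  trichotomy false false _ = refl
  trichotomy false true  _ = refl

edges≡sum : ∀ {n} (G : Graph n) →
  edges G ≡ sum (λ i → sum (λ j → fromBool ((toℕ i <ᵇ toℕ j) ∧ Adj G i j)))
edges≡sum {n} G = trans (sum-tabulate (λ i → ListAction.sum (List.map (λ j → if (toℕ i <ᵇ toℕ j) ∧ Adj G i j then 1 else 0) (allFin n))) (λ i → i))
  (sum-cong-≗ (λ i → sum-tabulate (λ j → if (toℕ i <ᵇ toℕ j) ∧ Adj G i j then 1 else 0) (λ j → j)))

twice-edges : ∀ {n} (G : Graph n) → 2 * edges G ≡ sum (degree G)
twice-edges {n} G = begin
    2 * edges G                                    ≡⟨ cong (λ e → e + (e + 0)) (edges≡sum G) ⟩
    E + (E + 0)                                    ≡⟨ cong (E +_) (+-identityʳ E) ⟩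
    E + E                                          ≡⟨ cong (E +_) (∑-comm up) ⟩
    E + sum (λ i → sum (λ j → up j i))             ≡⟨ sym (∑-distrib-+ (λ i → sum (up i)) (λ i → sum (λ j → up j i))) ⟩
    sum (λ i → sum (up i) + sum (λ j → up j i))    ≡⟨ sum-cong-≗ (λ i → sym (∑-distrib-+ (up i) (λ j → up j i))) ⟩
    sum (λ i → sum (λ j → up i j + up j i))        ≡⟨ sum-cong-≗ (λ i → sum-cong-≗ (λ j → up+down i j)) ⟩
    sum (degree G)                                 ∎
  where
  open ≡-Reasoning
  up : Fin n → Fin n → ℕ
  up i j = fromBool ((toℕ i <ᵇ toℕ j) ∧ Adj G i j)
  E = sum (λ i → sum (up i))
  <ᵇ-trichotomy : ∀ a b → (a ≡ᵇ b) ≡ false → fromBool (a <ᵇ b) + fromBool (b <ᵇ a) ≡ 1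
  <ᵇ-trichotomy zero    (suc b) _ = refl
  <ᵇ-trichotomy (suc a) zero    _ = refl
  <ᵇ-trichotomy (suc a) (suc b) e = <ᵇ-trichotomy a b e
  one-way : ∀ x y a → (a ≡ true → fromBool x + fromBool y ≡ 1) → fromBool (x ∧ a) + fromBool (y ∧ a) ≡ fromBool a
  one-way x y false _ rewrite ∧-zeroʳ x | ∧-zeroʳ y = refl
  one-way x y true  h rewrite ∧-identityʳ x | ∧-identityʳ y = h refl
  up+down : ∀ i j → up i j + up j i ≡ fromBool (Adj G i j)
  up+down i j rewrite Graph.sym G j i =
    one-way (toℕ i <ᵇ toℕ j) (toℕ j <ᵇ toℕ i) (Adj G i j) (λ a → <ᵇ-trichotomy (toℕ i) (toℕ j) (≢⇒==false (Adj⇒≢ G a)))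

handshake : ∀ {n} (G : Graph n) → 2 * edges G + sum (nonDegree G) + n ≡ n * n
handshake {n} G = begin
    2 * edges G + sum (nonDegree G) + n
      ≡⟨ cong₂ (λ x y → x + sum (nonDegree G) + y) (twice-edges G) (sym (count-true n)) ⟩
    sum (degree G) + sum (nonDegree G) + count {n} (λ _ → true)
      ≡⟨ cong (_+ count {n} (λ _ → true)) (sym (∑-distrib-+ (degree G) (nonDegree G))) ⟩
    sum (λ i → degree G i + nonDegree G i) + count {n} (λ _ → true)
      ≡⟨ sym (∑-distrib-+ (λ i → degree G i + nonDegree G i) (λ _ → 1)) ⟩
    sum (λ i → degree G i + nonDegree G i + 1)
      ≡⟨ sum-cong-≗ (degree+nonDegree G) ⟩
    sum {n} (λ _ → n)
      ≡⟨ sum-const n n ⟩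
    n * n ∎
  where open ≡-Reasoning

-- Undominated sets

Undominated : ∀ {n} → Graph n → (Fin n → Bool) → Set
Undominated {n} G S = ∀ x → S x ≡ true → Σ (Fin n) λ y → S y ≡ true × NonAdj G x y ≡ true

star-centred-at : ∀ r k (G : Graph (r + k + 1)) (F : Subset (r + k + 1)) → ∣ F ∣ ≡ k →
  (c : Fin (r + k + 1)) → lookup F c ≡ false →
  (∀ y → lookup F y ≡ false → y ≢ c → Adj G c y ≡ true) → HasStarAvoiding r G F
star-centred-at r k G F ∣F∣≡k c c∉F c-adj =
  c , lookup-false⇒∉ F c∉F , leaf , leaf-inj , λ l →
    lookup-false⇒∉ F (outside (leaf-ok l)) ,
    c-adj (leaf l) (outside (leaf-ok l)) (λ e → ==false⇒≢ (not-true (∧-trueʳ {not (lookup F (leaf l))} (leaf-ok l))) (sym e))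
  where
  Leaf : Fin (r + k + 1) → Bool
  Leaf j = not (lookup F j) ∧ not (c == j)
  outside : ∀ {j} → Leaf j ≡ true → lookup F j ≡ false
  outside e = not-true (∧-trueˡ e)
  count-Leaf : count Leaf ≡ r
  count-Leaf = suc-injective (trans (sym (count-remove {P = λ i → not (lookup F i)} c (cong not c∉F)))
                                    (count-outside r k F ∣F∣≡k))
  leaves = enumerate Leaf r (≤-reflexive (sym count-Leaf))
  leaf = proj₁ leaves
  leaf-inj = proj₁ (proj₂ leaves)
  leaf-ok = proj₂ (proj₂ leaves)

-- The k vertices outside S must leave a star in S, whose centre has a non-neighbour in S.
stable⇒¬undominated : ∀ {r k} (G : Graph (r + k + 1)) → VertexStable r k G →
  (S : Fin (r + k + 1) → Bool) → count S ≡ suc r → ¬ Undominated G S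
stable⇒¬undominated {r} {k} G stable S ∣S∣ undominated = no-star (stable F ∣F∣≡k)
  where
  F : Subset (r + k + 1)
  F = tabulate (λ i → not (S i))
  ∣F∣≡k : ∣ F ∣ ≡ k
  ∣F∣≡k = begin
      ∣ F ∣                       ≡⟨ count-lookup F ⟩
      count (lookup F)            ≡⟨ count-cong (lookup∘tabulate (λ i → not (S i))) ⟩
      count (λ i → not (S i))     ≡⟨ +-cancelˡ-≡ (suc r) _ _ (trans (cong (_+ count (λ i → not (S i))) (sym ∣S∣))
                                       (trans (count-not S) (+-comm (r + k) 1))) ⟩
      k                           ∎
    where open ≡-Reasoning
  ∉F⇒S : ∀ x → x ∉ F → S x ≡ true
  ∉F⇒S x x∉F = not-false (trans (sym (lookup∘tabulate (λ i → not (S i)) x)) (∉⇒lookup-false x∉F))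
  no-star : ¬ HasStarAvoiding r G F
  no-star (c , c∉F , leaf , leaf-inj , leaf-ok) = <-irrefl refl too-many-leaves
    where
    Sc = ∉F⇒S c c∉F
    y = proj₁ (undominated c Sc)
    Sy = proj₁ (proj₂ (undominated c Sc))
    c≁y = proj₂ (proj₂ (undominated c Sc))
    Rest : Fin (r + k + 1) → Bool
    Rest i = (S i ∧ not (c == i)) ∧ not (y == i)
    ∣S∣≡2+∣Rest∣ : count S ≡ suc (suc (count Rest))
    ∣S∣≡2+∣Rest∣ = trans (count-remove c Sc)
      (cong suc (count-remove {P = λ i → S i ∧ not (c == i)} y (∧-true Sy (cong not (≢⇒==false (NonAdj⇒≢ G c≁y))))))
    leaf∈Rest : ∀ l → Rest (leaf l) ≡ true
    leaf∈Rest l = ∧-true (∧-true (∉F⇒S (leaf l) (proj₁ (leaf-ok l))) (cong not (≢⇒==false (Adj⇒≢ G (proj₂ (leaf-ok l))))))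
      (cong not (≢⇒==false {i = y} λ y≡leaf → t≢f (trans (sym (proj₂ (leaf-ok l))) (trans (cong (Adj G c) (sym y≡leaf)) (NonAdj⇒¬Adj G c≁y)))))
    too-many-leaves : count Rest < count Rest
    too-many-leaves = subst (_≤ count Rest) (suc-injective (trans (sym ∣S∣) ∣S∣≡2+∣Rest∣))
                (injection-count r Rest leaf leaf-inj leaf∈Rest)

small-steps-hit : ∀ (s : ℕ → ℕ) M N → s 0 ≤ M → M ≤ s N → (∀ t → s (suc t) ≤ 2 + s t) →
  Σ ℕ λ t → M ≤ s t × s t ≤ suc M
small-steps-hit s M zero    s₀≤M M≤s _ = 0 , M≤s , ≤-trans s₀≤M (n≤1+n M)
small-steps-hit s M (suc N) s₀≤M M≤s step with M ≤? s N
... | yes M≤sN = small-steps-hit s M N s₀≤M M≤sN step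
... | no M≰sN = suc N , M≤s , ≤-trans (step N) (s≤s (≰⇒> M≰sN))

module Growth {n} (G : Graph n) (Seed Q : Fin n → Bool) (partner : Fin n → Fin n) where

  Stage : ℕ → Fin n → Bool
  Stage t y = Seed y ∨ anyᵇ (λ x → ((toℕ x <ᵇ t) ∧ Q x) ∧ ((y == x) ∨ (y == partner x)))

  stage-elim : ∀ t y → Stage t y ≡ true → Seed y ≡ true ⊎
    Σ (Fin n) λ x → (toℕ x <ᵇ t) ≡ true × Q x ≡ true × (y ≡ x ⊎ y ≡ partner x)
  stage-elim t y e with ∨-true e
  ... | inj₁ seed = inj₁ seed
  ... | inj₂ added with anyᵇ-witness added
  ...   | x , e′ = inj₂ (x , ∧-trueˡ (∧-trueˡ e′) , ∧-trueʳ {toℕ x <ᵇ t} (∧-trueˡ e′) , which (∨-true (∧-trueʳ {(toℕ x <ᵇ t) ∧ Q x} e′)))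
    where
    which : (y == x) ≡ true ⊎ (y == partner x) ≡ true → y ≡ x ⊎ y ≡ partner x
    which (inj₁ e″) = inj₁ (==⇒≡ e″)
    which (inj₂ e″) = inj₂ (==⇒≡ e″)

  seed⊆stage : ∀ t y → Seed y ≡ true → Stage t y ≡ true
  seed⊆stage t y seed = ∨-trueˡ _ seed

  stage-vertex : ∀ t x → (toℕ x <ᵇ t) ≡ true → Q x ≡ true → Stage t x ≡ true
  stage-vertex t x lt q = ∨-trueʳ (Seed x) (anyᵇ-intro x (∧-true (∧-true lt q) (∨-trueˡ _ (==-refl x))))

  stage-partner : ∀ t x → (toℕ x <ᵇ t) ≡ true → Q x ≡ true → Stage t (partner x) ≡ true
  stage-partner t x lt q = ∨-trueʳ (Seed (partner x))
    (anyᵇ-intro x (∧-true (∧-true lt q) (∨-trueʳ (partner x == x) (==-refl (partner x)))))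

  count-stage₀ : count (Stage 0) ≡ count Seed
  count-stage₀ = count-cong λ y →
    trans (cong (Seed y ∨_) (anyᵇ-none (λ x → cong (λ b → (b ∧ Q x) ∧ ((y == x) ∨ (y == partner x))) (<ᵇ-zero (toℕ x)))))
          (∨-identityʳ (Seed y))

  stage-mono : ∀ t y → Stage t y ≡ true → Stage (suc t) y ≡ true
  stage-mono t y e with stage-elim t y e
  ... | inj₁ seed = seed⊆stage (suc t) y seed
  ... | inj₂ (x , lt , q , inj₁ refl) = stage-vertex (suc t) x (<ᵇ-weaken (toℕ x) t lt) q
  ... | inj₂ (x , lt , q , inj₂ refl) = stage-partner (suc t) x (<ᵇ-weaken (toℕ x) t lt) q

  stage-final : ∀ y → Q y ≡ true → Stage n y ≡ true
  stage-final y q = stage-vertex n y (<⇒<ᵇ-true (toℕ<n y)) q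

  stage-suc : ∀ t y → Stage (suc t) y ≡ true → Stage t y ≡ true ⊎
    Σ (Fin n) λ x → toℕ x ≡ t × Q x ≡ true × (y ≡ x ⊎ y ≡ partner x)
  stage-suc t y e with stage-elim (suc t) y e
  ... | inj₁ seed = inj₁ (seed⊆stage t y seed)
  ... | inj₂ (x , lt , q , y≡) with <ᵇ-suc (toℕ x) t lt
  ...   | inj₂ x≡t = inj₂ (x , x≡t , q , y≡)
  ...   | inj₁ x<t with y≡
  ...     | inj₁ refl = inj₁ (stage-vertex t x x<t q)
  ...     | inj₂ refl = inj₁ (stage-partner t x x<t q)

  stage-growth : ∀ t → count (Stage (suc t)) ≤ 2 + count (Stage t)
  stage-growth t = begin
      count (Stage (suc t))
        ≤⟨ count-mono {Q = λ y → (image-at (λ x → x) y ∨ image-at partner y) ∨ Stage t y} covered ⟩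
      count (λ y → (image-at (λ x → x) y ∨ image-at partner y) ∨ Stage t y)
        ≤⟨ count-∨ (λ y → image-at (λ x → x) y ∨ image-at partner y) (Stage t) ⟩
      count (λ y → image-at (λ x → x) y ∨ image-at partner y) + count (Stage t)
        ≤⟨ +-monoˡ-≤ (count (Stage t)) (≤-trans (count-∨ (image-at (λ x → x)) (image-at partner))
                                                  (+-mono-≤ (count-image-at (λ x → x)) (count-image-at partner))) ⟩
      2 + count (Stage t) ∎
    where
    open ≤-Reasoning
    image-at : (Fin n → Fin n) → Fin n → Bool
    image-at φ y = anyᵇ (λ x → (toℕ x ≡ᵇ t) ∧ (φ x == y))
    image-at-intro : ∀ φ x → toℕ x ≡ t → image-at φ (φ x) ≡ true
    image-at-intro φ x refl = anyᵇ-intro x (∧-true (T⇒true (≡⇒≡ᵇ (toℕ x) (toℕ x) refl)) (==-refl (φ x)))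
    count-image-at : ∀ φ → count (image-at φ) ≤ 1
    count-image-at φ = count≤1 {P = image-at φ} λ i j ei ej → same (anyᵇ-witness ei) (anyᵇ-witness ej)
      where
      same : ∀ {i j} → Σ (Fin n) (λ x → ((toℕ x ≡ᵇ t) ∧ (φ x == i)) ≡ true) →
                       Σ (Fin n) (λ x → ((toℕ x ≡ᵇ t) ∧ (φ x == j)) ≡ true) → i ≡ j
      same (x , ex) (x′ , ex′)
        with toℕ-injective {i = x} {j = x′}
               (trans (≡ᵇ⇒≡ (toℕ x) t (true⇒T ((∧-trueˡ ex)))) (sym (≡ᵇ⇒≡ (toℕ x′) t (true⇒T ((∧-trueˡ ex′))))))
      ... | refl = trans (sym (==⇒≡ {i = φ x} (∧-trueʳ {toℕ x ≡ᵇ t} ex))) (==⇒≡ {i = φ x} (∧-trueʳ {toℕ x ≡ᵇ t} ex′))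
    covered : ∀ y → Stage (suc t) y ≡ true → ((image-at (λ x → x) y ∨ image-at partner y) ∨ Stage t y) ≡ true
    covered y e with stage-suc t y e
    ... | inj₁ old = ∨-trueʳ (image-at (λ x → x) y ∨ image-at partner y) old
    ... | inj₂ (x , x≡t , _ , inj₁ refl) = ∨-trueˡ (Stage t x) (∨-trueˡ (image-at partner x) (image-at-intro (λ z → z) x x≡t))
    ... | inj₂ (x , x≡t , _ , inj₂ refl) = ∨-trueˡ (Stage t (partner x)) (∨-trueʳ (image-at (λ z → z) (partner x)) (image-at-intro partner x x≡t))

  stage-undominated : Undominated G Seed → (∀ x → Q x ≡ true → NonAdj G x (partner x) ≡ true) →
    ∀ t → Undominated G (Stage t)
  stage-undominated seed-ok partner-ok t y e with stage-elim t y e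
  ... | inj₁ seed = let (z , Sz , y≁z) = seed-ok y seed in z , seed⊆stage t z Sz , y≁z
  ... | inj₂ (x , lt , q , inj₁ refl) = partner x , stage-partner t x lt q , partner-ok x q
  ... | inj₂ (x , lt , q , inj₂ refl) = x , stage-vertex t x lt q , trans (NonAdj-sym G (partner x) x) (partner-ok x q)

Deficient : ∀ {n} → Graph n → Fin n → Bool
Deficient G x = anyᵇ (NonAdj G x)

deficient-witness : ∀ {n} (G : Graph n) {x} → Deficient G x ≡ true → Σ (Fin n) λ y → NonAdj G x y ≡ true
deficient-witness G e = anyᵇ-witness e

deficient-intro : ∀ {n} (G : Graph n) {x y} → NonAdj G x y ≡ true → Deficient G x ≡ true
deficient-intro G {y = y} e = anyᵇ-intro y e

¬deficient⇒¬NonAdj : ∀ {n} (G : Graph n) {x} → Deficient G x ≡ false → ∀ y → NonAdj G x y ≡ false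
¬deficient⇒¬NonAdj G {x} = anyᵇ-false {P = NonAdj G x}

nonDegree-¬deficient : ∀ {n} (G : Graph n) {x} → Deficient G x ≡ false → nonDegree G x ≡ 0
nonDegree-¬deficient G {x} e = count-false {P = NonAdj G x} (¬deficient⇒¬NonAdj G e)

deficient-partner : ∀ {n} (G : Graph n) {x y} → NonAdj G x y ≡ true → Deficient G y ≡ true
deficient-partner G {x} {y} e = deficient-intro G (trans (NonAdj-sym G y x) e)

≤-suc-cases : ∀ {a b} → a ≤ b → b ≤ suc a → b ≡ a ⊎ b ≡ suc a
≤-suc-cases a≤b b≤1+a with m≤n⇒m<n∨m≡n a≤b
... | inj₂ a≡b = inj₁ (sym a≡b)
... | inj₁ a<b = inj₂ (≤-antisym b≤1+a a<b)

UndominatedOfSize : ∀ {n} → Graph n → ℕ → Set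
UndominatedOfSize {n} G m = Σ (Fin n → Bool) λ S → count S ≡ m × Undominated G S

module TwoNonNeighbours {n} (G : Graph n) (v a b : Fin n)
                        (v≁a : NonAdj G v a ≡ true) (v≁b : NonAdj G v b ≡ true) (a≢b : a ≢ b) where

  SoleNonNeighbour : Fin n → Fin n → Set
  SoleNonNeighbour y w = ∀ g → NonAdj G y g ≡ true → g ≡ w

  Spare : Fin n → Bool
  Spare f = allᵇ (λ y → (y == f) ∨ (not (Deficient G y) ∨ anyᵇ (λ g → NonAdj G y g ∧ not (g == f))))

  ¬spare : ∀ f → Spare f ≡ false →
    Σ (Fin n) λ y → y ≢ f × Deficient G y ≡ true × SoleNonNeighbour y f
  ¬spare f e with allᵇ-counterexample e
  ... | y , e′ = y , ==false⇒≢ (∨-falseˡ e′) , not-false (∨-falseˡ (∨-falseʳ {y == f} e′)) ,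
                 λ g y≁g → ==⇒≡ (not-false (∧-falseʳ (anyᵇ-false (∨-falseʳ {not (Deficient G y)} (∨-falseʳ {y == f} e′)) g) y≁g))
    where
    ∨-falseˡ : ∀ {p q} → (p ∨ q) ≡ false → p ≡ false
    ∨-falseˡ {false} _ = refl
    ∨-falseʳ : ∀ {p q} → (p ∨ q) ≡ false → q ≡ false
    ∨-falseʳ {false} e = e

  -- If no deficient vertex were spare, v would be the sole non-neighbour of some y and y the sole
  -- non-neighbour of v, contradicting a ≢ b.
  spare-exists : Σ (Fin n) λ f → (Deficient G f ∧ Spare f) ≡ true
  spare-exists with find (λ f → Deficient G f ∧ Spare f)
  ... | inj₁ w = w
  ... | inj₂ none = ⊥-elim (a≢b (trans (v-sole a v≁a) (sym (v-sole b v≁b))))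
    where
    y-of-v = ¬spare v (∧-falseʳ (none v) (deficient-intro G v≁a))
    y = proj₁ y-of-v
    y-deficient = proj₁ (proj₂ (proj₂ y-of-v))
    z-of-y = ¬spare y (∧-falseʳ (none y) y-deficient)
    z = proj₁ z-of-y
    z-sole = proj₂ (proj₂ (proj₂ z-of-y))
    z≡v : z ≡ v
    z≡v = let (g , z≁g) = deficient-witness G (proj₁ (proj₂ (proj₂ z-of-y))) in
          proj₂ (proj₂ (proj₂ y-of-v)) z
            (trans (NonAdj-sym G y z) (subst (λ x → NonAdj G z x ≡ true) (z-sole g z≁g) z≁g))
    v-sole : SoleNonNeighbour v y
    v-sole = subst (λ w → SoleNonNeighbour w y) z≡v z-sole

  f : Fin n
  f = proj₁ spare-exists

  f-deficient : Deficient G f ≡ true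
  f-deficient = ∧-trueˡ (proj₂ spare-exists)

  partner : Fin n → Fin n
  partner x = choose (λ g → NonAdj G x g ∧ not (g == f)) x

  partner-spec : ∀ x → Deficient G x ≡ true → NonAdj G x (partner x) ≡ true × partner x ≢ f
  partner-spec x x-deficient = from (choose-spec (λ g → NonAdj G x g ∧ not (g == f)) x (proj₁ other) (proj₂ other))
    where
    from : (NonAdj G x (partner x) ∧ not (partner x == f)) ≡ true → NonAdj G x (partner x) ≡ true × partner x ≢ f
    from e = ∧-trueˡ e , ==false⇒≢ (not-true (∧-trueʳ {NonAdj G x (partner x)} e))
    other : Σ (Fin n) λ g → (NonAdj G x g ∧ not (g == f)) ≡ true
    other with x == f in x≡f
    ... | true = let (g , x≁g) = deficient-witness G x-deficient in
                 g , ∧-true x≁g (cong not (≢⇒==false (λ g≡f → NonAdj⇒≢ G x≁g (trans (==⇒≡ x≡f) (sym g≡f)))))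
    ... | false = anyᵇ-witness (spare x≡f x-deficient (allᵇ-elim (∧-trueʳ {Deficient G f} (proj₂ spare-exists)) x))
      where
      spare : ∀ {p q s} → p ≡ false → q ≡ true → (p ∨ (not q ∨ s)) ≡ true → s ≡ true
      spare refl refl e = e

  g₀ g₁ : Fin n
  g₀ = partner f
  g₁ = partner g₀

  f≁g₀ : NonAdj G f g₀ ≡ true
  f≁g₀ = proj₁ (partner-spec f f-deficient)

  g₀≁g₁ : NonAdj G g₀ g₁ ≡ true
  g₀≁g₁ = proj₁ (partner-spec g₀ (deficient-partner G f≁g₀))

  Seed : Fin n → Bool
  Seed y = (g₀ == y) ∨ (g₁ == y)

  Q : Fin n → Bool
  Q x = Deficient G x ∧ not (f == x)

  open Growth G Seed Q partner

  seed-undominated : Undominated G Seed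
  seed-undominated y e with ∨-true e
  ... | inj₁ g₀≡y = g₁ , ∨-trueʳ (g₀ == g₁) (==-refl g₁) , subst (λ w → NonAdj G w g₁ ≡ true) (==⇒≡ g₀≡y) g₀≁g₁
  ... | inj₂ g₁≡y = g₀ , ∨-trueˡ (g₁ == g₀) (==-refl g₀) ,
                    subst (λ w → NonAdj G w g₀ ≡ true) (==⇒≡ g₁≡y) (trans (NonAdj-sym G g₁ g₀) g₀≁g₁)

  partner-ok : ∀ x → Q x ≡ true → NonAdj G x (partner x) ≡ true
  partner-ok x e = proj₁ (partner-spec x (∧-trueˡ e))

  count-seed : count Seed ≡ 2
  count-seed = trans (count-∨-disjoint (g₀ ==_) (g₁ ==_) disjoint) (cong₂ _+_ (count-singleton g₀) (count-singleton g₁))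
    where
    disjoint : ∀ i → (g₀ == i) ≡ true → (g₁ == i) ≡ false
    disjoint i e = ≢⇒==false (λ g₁≡i → NonAdj⇒≢ G g₀≁g₁ (trans (==⇒≡ e) (sym g₁≡i)))

  f∉stage : ∀ t → Stage t f ≡ false
  f∉stage t with Stage t f in e
  ... | false = refl
  ... | true with stage-elim t f e
  ...   | inj₂ (x , _ , q , inj₁ refl) = ⊥-elim (t≢f (trans (sym (==-refl f)) (not-true (∧-trueʳ {Deficient G f} q))))
  ...   | inj₂ (x , _ , q , inj₂ f≡px) = ⊥-elim (proj₂ (partner-spec x (∧-trueˡ q)) (sym f≡px))
  ...   | inj₁ seed with ∨-true seed
  ...     | inj₁ g₀≡f = ⊥-elim (proj₂ (partner-spec f f-deficient) (==⇒≡ g₀≡f))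
  ...     | inj₂ g₁≡f = ⊥-elim (proj₂ (partner-spec g₀ (deficient-partner G f≁g₀)) (==⇒≡ g₁≡f))

  -- If the stages hit M instead of M + 1, add f: its non-neighbour g₀ lies in every stage.
  undominated-of-size : ∀ m → 3 ≤ m → m ≤ count (Deficient G) → UndominatedOfSize G m
  undominated-of-size (suc M) (s≤s 2≤M) m≤W
    with small-steps-hit (λ t → count (Stage t)) M n (≤-trans (≤-reflexive (trans count-stage₀ count-seed)) 2≤M) M≤final stage-growth
    where
    covered : ∀ y → Deficient G y ≡ true → (Stage n y ∨ (f == y)) ≡ true
    covered y y-deficient with f == y in e
    ... | true = ∨-trueʳ (Stage n y) refl
    ... | false = ∨-trueˡ false (stage-final y (∧-true y-deficient (cong not e)))
    M≤final : M ≤ count (Stage n)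
    M≤final = ≤-pred (≤-trans m≤W (≤-trans (count-mono covered) (≤-trans (count-∨ (Stage n) (f ==_))
                (≤-reflexive (trans (cong (count (Stage n) +_) (count-singleton f)) (+-comm (count (Stage n)) 1))))))
  ... | t , M≤ , ≤1+M with ≤-suc-cases M≤ ≤1+M
  ...   | inj₂ hit = Stage t , hit , stage-undominated seed-undominated partner-ok t
  ...   | inj₁ hit = S , count-S , S-undominated
    where
    S : Fin n → Bool
    S y = Stage t y ∨ (f == y)
    count-S : count S ≡ suc M
    count-S = trans (count-∨-disjoint (Stage t) (f ==_) disjoint) (trans (cong₂ _+_ hit (count-singleton f)) (+-comm M 1))
      where
      disjoint : ∀ i → Stage t i ≡ true → (f == i) ≡ false
      disjoint i e = ≢⇒==false {i = f} (λ { refl → t≢f (trans (sym e) (f∉stage t)) })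
    S-undominated : Undominated G S
    S-undominated y e with ∨-true e
    ... | inj₁ old = let (z , Sz , y≁z) = stage-undominated seed-undominated partner-ok t y old in z , ∨-trueˡ (f == z) Sz , y≁z
    ... | inj₂ f≡y = g₀ , ∨-trueˡ (f == g₀) (seed⊆stage t g₀ (∨-trueˡ (g₁ == g₀) (==-refl g₀))) ,
                     subst (λ w → NonAdj G w g₀ ≡ true) (==⇒≡ f≡y) f≁g₀

NonEdgesMatching : ∀ {n} → Graph n → Set
NonEdgesMatching {n} G = ∀ (x y y′ : Fin n) → NonAdj G x y ≡ true → NonAdj G x y′ ≡ true → y ≡ y′

even≢odd′ : ∀ c q → c * 2 ≢ suc (q * 2)
even≢odd′ c q e = even≢odd c q (trans (*-comm 2 c) (trans e (cong suc (*-comm q 2))))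

module MatchingGrowth {n} (G : Graph n) (matching : NonEdgesMatching G) where

  partner : Fin n → Fin n
  partner x = choose (NonAdj G x) x

  partner-spec : ∀ x → Deficient G x ≡ true → NonAdj G x (partner x) ≡ true
  partner-spec x x-deficient = let (g , x≁g) = deficient-witness G x-deficient in choose-spec (NonAdj G x) x g x≁g

  partner-involutive : ∀ x → Deficient G x ≡ true → partner (partner x) ≡ x
  partner-involutive x x-deficient =
    matching (partner x) (partner (partner x)) x (partner-spec (partner x) (deficient-intro G px≁x)) px≁x
    where
    px≁x : NonAdj G (partner x) x ≡ true
    px≁x = trans (NonAdj-sym G (partner x) x) (partner-spec x x-deficient)

  open Growth G (λ _ → false) (Deficient G) partner

  count-stage₀≡0 : count (Stage 0) ≡ 0
  count-stage₀≡0 = trans count-stage₀ (count-false {n} {λ _ → false} (λ _ → refl))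

  stage-closed : ∀ t y → Stage t y ≡ true → Stage t (partner y) ≡ true
  stage-closed t y e with stage-elim t y e
  ... | inj₁ ()
  ... | inj₂ (x , lt , q , inj₁ refl) = stage-partner t x lt q
  ... | inj₂ (x , lt , q , inj₂ refl) = subst (λ z → Stage t z ≡ true) (sym (partner-involutive x q)) (stage-vertex t x lt q)

  stage-step-old : ∀ t → (∀ x → toℕ x ≡ t → Deficient G x ≡ true → Stage t x ≡ true) →
    count (Stage (suc t)) ≡ count (Stage t)
  stage-step-old t index-t-in = ≤-antisym (count-mono old) (count-mono (stage-mono t))
    where
    old : ∀ y → Stage (suc t) y ≡ true → Stage t y ≡ true
    old y e with stage-suc t y e
    ... | inj₁ q = q
    ... | inj₂ (x , x≡t , d , inj₁ refl) = index-t-in x x≡t d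
    ... | inj₂ (x , x≡t , d , inj₂ refl) = stage-closed t x (index-t-in x x≡t d)

  -- partner x₀ is new as well, since stages are closed under partner.
  stage-step-new : ∀ t x₀ → toℕ x₀ ≡ t → Deficient G x₀ ≡ true → Stage t x₀ ≡ false →
    count (Stage (suc t)) ≡ 2 + count (Stage t)
  stage-step-new t x₀ x₀≡t x₀-deficient x₀∉ = trans (≤-antisym (count-mono sub) (count-mono sup)) count-R
    where
    x₀<1+t : (toℕ x₀ <ᵇ suc t) ≡ true
    x₀<1+t = <⇒<ᵇ-true (≤-reflexive (cong suc x₀≡t))
    R : Fin n → Bool
    R y = (Stage t y ∨ (x₀ == y)) ∨ (partner x₀ == y)
    sub : ∀ y → Stage (suc t) y ≡ true → R y ≡ true
    sub y e with stage-suc t y e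
    ... | inj₁ q = ∨-trueˡ _ (∨-trueˡ _ q)
    ... | inj₂ (x , x≡t , _ , y≡) with toℕ-injective {i = x} {j = x₀} (trans x≡t (sym x₀≡t))
    ...   | refl with y≡
    ...     | inj₁ refl = ∨-trueˡ _ (∨-trueʳ (Stage t x) (==-refl x))
    ...     | inj₂ refl = ∨-trueʳ (Stage t (partner x) ∨ (x == partner x)) (==-refl (partner x))
    sup : ∀ y → R y ≡ true → Stage (suc t) y ≡ true
    sup y e with ∨-true e
    ... | inj₂ q = subst (λ z → Stage (suc t) z ≡ true) (==⇒≡ {i = partner x₀} q) (stage-partner (suc t) x₀ x₀<1+t x₀-deficient)
    ... | inj₁ q with ∨-true q
    ...   | inj₁ q′ = stage-mono t y q′
    ...   | inj₂ q′ = subst (λ z → Stage (suc t) z ≡ true) (==⇒≡ {i = x₀} q′) (stage-vertex (suc t) x₀ x₀<1+t x₀-deficient)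
    px₀∉ : Stage t (partner x₀) ≡ false
    px₀∉ with Stage t (partner x₀) in e
    ... | false = refl
    ... | true = ⊥-elim (t≢f (trans (sym (subst (λ z → Stage t z ≡ true) (partner-involutive x₀ x₀-deficient)
                                                  (stage-closed t (partner x₀) e))) x₀∉))
    disjoint₁ : ∀ i → Stage t i ≡ true → (x₀ == i) ≡ false
    disjoint₁ i e = ≢⇒==false {i = x₀} (λ { refl → t≢f (trans (sym e) x₀∉) })
    disjoint₂ : ∀ i → (Stage t i ∨ (x₀ == i)) ≡ true → (partner x₀ == i) ≡ false
    disjoint₂ i e with ∨-true e
    ... | inj₁ old = ≢⇒==false {i = partner x₀} (λ { refl → t≢f (trans (sym old) px₀∉) })
    ... | inj₂ q = ≢⇒==false {i = partner x₀} (λ px₀≡i → NonAdj⇒≢ G (partner-spec x₀ x₀-deficient) (trans (==⇒≡ q) (sym px₀≡i)))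
    count-R : count R ≡ 2 + count (Stage t)
    count-R = begin
        count R                                                       ≡⟨ count-∨-disjoint (λ y → Stage t y ∨ (x₀ == y)) (partner x₀ ==_) disjoint₂ ⟩
        count (λ y → Stage t y ∨ (x₀ == y)) + count (partner x₀ ==_)  ≡⟨ cong₂ _+_ (count-∨-disjoint (Stage t) (x₀ ==_) disjoint₁) (count-singleton (partner x₀)) ⟩
        count (Stage t) + count (x₀ ==_) + 1                          ≡⟨ cong (λ z → count (Stage t) + z + 1) (count-singleton x₀) ⟩
        count (Stage t) + 1 + 1                                       ≡⟨ +-comm (count (Stage t) + 1) 1 ⟩
        1 + (count (Stage t) + 1)                                     ≡⟨ cong suc (+-comm (count (Stage t)) 1) ⟩
        2 + count (Stage t)                                           ∎
      where open ≡-Reasoning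

  stage-step : ∀ t → count (Stage (suc t)) ≡ count (Stage t) ⊎ count (Stage (suc t)) ≡ 2 + count (Stage t)
  stage-step t with find (λ x → ((toℕ x ≡ᵇ t) ∧ Deficient G x) ∧ not (Stage t x))
  ... | inj₂ none = inj₁ (stage-step-old t λ x x≡t d → not-false (∧-falseʳ (none x) (∧-true (T⇒true (≡⇒≡ᵇ (toℕ x) t x≡t)) d)))
  ... | inj₁ (x₀ , e₀) = inj₂ (stage-step-new t x₀ (≡ᵇ⇒≡ (toℕ x₀) t (true⇒T ((∧-trueˡ (∧-trueˡ e₀)))))
                                 (∧-trueʳ {toℕ x₀ ≡ᵇ t} (∧-trueˡ e₀)) (not-true (∧-trueʳ {(toℕ x₀ ≡ᵇ t) ∧ Deficient G x₀} e₀)))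

  count-stage-even : ∀ t → Σ ℕ λ c → count (Stage t) ≡ c * 2
  count-stage-even zero = 0 , count-stage₀≡0
  count-stage-even (suc t) with count-stage-even t | stage-step t
  ... | c , e | inj₁ same = c , trans same e
  ... | c , e | inj₂ two = suc c , trans two (cong (2 +_) e)

  undominated-of-even-size : ∀ q → q * 2 ≤ count (Deficient G) → UndominatedOfSize G (q * 2)
  undominated-of-even-size q 2q≤W
    with small-steps-hit (λ t → count (Stage t)) (q * 2) n
           (≤-trans (≤-reflexive count-stage₀≡0) z≤n)
           (≤-trans 2q≤W (count-mono (λ y d → stage-final y d))) stage-growth
  ... | t , 2q≤ , ≤1+2q with ≤-suc-cases 2q≤ ≤1+2q | count-stage-even t
  ...   | inj₁ hit | _ = Stage t , hit , stage-undominated (λ _ ()) partner-spec t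
  ...   | inj₂ odd | c , even = ⊥-elim (even≢odd′ c q (trans (sym even) odd))

-- The structure of a stable graph

pairs-mono : ∀ {a b} → a ≤ b → a * (a ∸ 1) ≤ b * (b ∸ 1)
pairs-mono a≤b = *-mono-≤ a≤b (∸-monoˡ-≤ 1 a≤b)

pairs-mono-< : ∀ {a b} → 2 ≤ b → a < b → a * (a ∸ 1) < b * (b ∸ 1)
pairs-mono-< {b = suc zero} (s≤s ()) _
pairs-mono-< {a} {suc (suc b)} _ a<b = ≤-<-trans (*-monoʳ-≤ a (∸-monoˡ-≤ 1 (<⇒≤ a<b))) (*-monoˡ-< (suc b) a<b)

sum-indicator : ∀ {n} (P : Fin n → Bool) c → sum (λ x → fromBool (P x) * c) ≡ count P * c
sum-indicator P c = sym (*-distribʳ-sum c (λ x → fromBool (P x)))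

nonNeighbours⊆deficient : ∀ {n} (G : Graph n) x y → NonAdj G x y ≡ true → (Deficient G y ∧ not (x == y)) ≡ true
nonNeighbours⊆deficient G x y x≁y = ∧-true (deficient-partner G x≁y) (∧-trueʳ {not (Adj G x y)} x≁y)

nonDegree≤ : ∀ {n} (G : Graph n) x → nonDegree G x ≤ fromBool (Deficient G x) * (count (Deficient G) ∸ 1)
nonDegree≤ G x with Deficient G x in x-deficient
... | false = ≤-reflexive (nonDegree-¬deficient G x-deficient)
... | true = begin
    count (NonAdj G x)                                 ≤⟨ count-mono (nonNeighbours⊆deficient G x) ⟩
    count (λ y → Deficient G y ∧ not (x == y))         ≡⟨ cong (_∸ 1) (count-remove x x-deficient) ⟨
    count (Deficient G) ∸ 1                            ≡⟨ +-identityʳ _ ⟨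
    1 * (count (Deficient G) ∸ 1)                      ∎
  where open ≤-Reasoning

sum-nonDegree≤ : ∀ {n} (G : Graph n) → sum (nonDegree G) ≤ count (Deficient G) * (count (Deficient G) ∸ 1)
sum-nonDegree≤ G = ≤-trans (sum-mono (nonDegree≤ G)) (≤-reflexive (sum-indicator (Deficient G) _))

GRKShape : ∀ {n} → Graph n → Set
GRKShape {n} G = ∀ (i j : Fin n) → Adj G i j ≡ not (i == j) ∧ (not (Deficient G i) ∨ not (Deficient G j))

sum-nonDegree-tight⇒GRKShape : ∀ {n} (G : Graph n) →
  sum (nonDegree G) ≡ count (Deficient G) * (count (Deficient G) ∸ 1) → GRKShape G
sum-nonDegree-tight⇒GRKShape G tight i j with i == j in i≡j
... | true = subst (λ z → Adj G i z ≡ false) (==⇒≡ i≡j) (irrefl G i)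
... | false with Deficient G i in di | Deficient G j in dj
...   | false | _ = ¬NonAdj⇒Adj G (==false⇒≢ i≡j) (¬deficient⇒¬NonAdj G di j)
...   | true | false = trans (Graph.sym G i j) (¬NonAdj⇒Adj G (λ e → ==false⇒≢ i≡j (sym e)) (¬deficient⇒¬NonAdj G dj i))
...   | true | true = NonAdj⇒¬Adj G (count-mono-tight (nonNeighbours⊆deficient G i) count-tight j
                                       (∧-true dj (cong not i≡j)))
  where
  count-tight : nonDegree G i ≡ count (λ y → Deficient G y ∧ not (i == y))
  count-tight = begin
    nonDegree G i                                         ≡⟨ sum-mono-tight (nonDegree≤ G) (trans tight (sym (sum-indicator (Deficient G) _))) i ⟩
    fromBool (Deficient G i) * (count (Deficient G) ∸ 1)  ≡⟨ cong (λ b → fromBool b * (count (Deficient G) ∸ 1)) di ⟩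
    1 * (count (Deficient G) ∸ 1)                         ≡⟨ +-identityʳ _ ⟩
    count (Deficient G) ∸ 1                               ≡⟨ cong (_∸ 1) (count-remove i di) ⟩
    count (λ y → Deficient G y ∧ not (i == y))            ∎
    where open ≡-Reasoning

nonDegree-matching : ∀ {n} (G : Graph n) → NonEdgesMatching G → ∀ x → nonDegree G x ≡ fromBool (Deficient G x)
nonDegree-matching G matching x with Deficient G x in x-deficient
... | false = nonDegree-¬deficient G x-deficient
... | true = ≤-antisym (count≤1 {P = NonAdj G x} (matching x))
                       (let (y , x≁y) = deficient-witness G x-deficient in count-pos y x≁y)

sum-nonDegree-matching : ∀ {n} (G : Graph n) → NonEdgesMatching G → sum (nonDegree G) ≡ count (Deficient G)
sum-nonDegree-matching G matching = sum-cong-≗ (nonDegree-matching G matching)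

even⇒≡ : ∀ {m} → Even m → m ≡ m / 2 * 2
even⇒≡ {m} even = trans (m≡m%n+[m/n]*n m 2) (cong (_+ m / 2 * 2) even)

odd⇒≡ : ∀ {m} → Odd m → m ≡ suc (m / 2 * 2)
odd⇒≡ {m} odd = trans (m≡m%n+[m/n]*n m 2) (cong (_+ m / 2 * 2) odd)

data NonEdgeStructure (r : ℕ) {n} (G : Graph n) : Set where
  spread   : sum (nonDegree G) ≤ r * (r ∸ 1) →
             (sum (nonDegree G) ≡ r * (r ∸ 1) → count (Deficient G) ≡ r × GRKShape G) →
             NonEdgeStructure r G
  matching : NonEdgesMatching G → sum (nonDegree G) ≡ count (Deficient G) →
             (Odd r → count (Deficient G) ≤ r) → NonEdgeStructure r G

module _ {r k} (G : Graph (r + k + 1)) (r≥3 : 3 ≤ r) (stable : VertexStable r k G) where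

  -- Beyond r deficient vertices there would be an undominated set of size r + 1.
  deficient≤r : (∀ m → 3 ≤ m → m ≤ count (Deficient G) → UndominatedOfSize G m) → count (Deficient G) ≤ r
  deficient≤r grow with count (Deficient G) ≤? r
  ... | yes w≤r = w≤r
  ... | no w≰r with grow (suc r) (≤-trans (s≤s (s≤s (s≤s z≤n))) (s≤s (≤-trans (n≤1+n 2) r≥3))) (≰⇒> w≰r)
  ...   | S , ∣S∣ , undominated = ⊥-elim (stable⇒¬undominated G stable S ∣S∣ undominated)

  odd-deficient≤r : NonEdgesMatching G → Odd r → count (Deficient G) ≤ r
  odd-deficient≤r matched odd with count (Deficient G) ≤? r
  ... | yes w≤r = w≤r
  ... | no w≰r = ⊥-elim (stable⇒¬undominated G stable S (trans ∣S∣ (cong suc (sym (odd⇒≡ odd)))) undominated)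
    where
    grown = MatchingGrowth.undominated-of-even-size G matched (suc (r / 2))
              (subst (_≤ count (Deficient G)) (cong suc (odd⇒≡ odd)) (≰⇒> w≰r))
    S = proj₁ grown
    ∣S∣ = proj₁ (proj₂ grown)
    undominated = proj₂ (proj₂ grown)

  structure : NonEdgeStructure r G
  structure with find (λ v → 1 <ᵇ nonDegree G v)
  ... | inj₁ (v , e) with two-witnesses (NonAdj G v) (<ᵇ⇒< 1 (nonDegree G v) (true⇒T e))
  ...   | a , b , v≁a , v≁b , a≢b = spread (≤-trans (sum-nonDegree≤ G) (pairs-mono w≤r)) tight
    where
    w≤r : count (Deficient G) ≤ r
    w≤r = deficient≤r (TwoNonNeighbours.undominated-of-size G v a b v≁a v≁b a≢b)
    tight : sum (nonDegree G) ≡ r * (r ∸ 1) → count (Deficient G) ≡ r × GRKShape G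
    tight H≡ = w≡r , sum-nonDegree-tight⇒GRKShape G (trans H≡ (sym (cong (λ w → w * (w ∸ 1)) w≡r)))
      where
      w≡r : count (Deficient G) ≡ r
      w≡r with m≤n⇒m<n∨m≡n w≤r
      ... | inj₂ w≡r = w≡r
      ... | inj₁ w<r = ⊥-elim (<-irrefl H≡ (≤-<-trans (sum-nonDegree≤ G) (pairs-mono-< (≤-trans (n≤1+n 2) r≥3) w<r)))
  structure | inj₂ none = matching matched (sum-nonDegree-matching G matched) (odd-deficient≤r matched)
    where
    matched : NonEdgesMatching G
    matched x y y′ x≁y x≁y′ with y ≟ y′
    ... | yes y≡y′ = y≡y′
    ... | no y≢y′ = ⊥-elim (t≢f (trans (sym (T⇒true (<⇒<ᵇ two))) (none x)))
      where
      two : 2 ≤ nonDegree G x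
      two = subst (2 ≤_) (sym (count-remove y x≁y))
                  (s≤s (count-pos {P = λ z → NonAdj G x z ∧ not (y == z)} y′ (∧-true x≁y′ (cong not (≢⇒==false y≢y′)))))

-- Isomorphisms

permutation-injective : ∀ {n} (π : Permutation′ n) {i j} → π ⟨$⟩ʳ i ≡ π ⟨$⟩ʳ j → i ≡ j
permutation-injective π {i} {j} e = trans (sym (inverseˡ π)) (trans (cong (π ⟨$⟩ˡ_) e) (inverseˡ π))

==-injective : ∀ {m n} (φ : Fin m → Fin n) → (∀ {i j} → φ i ≡ φ j → i ≡ j) → ∀ i j → (φ i == φ j) ≡ (i == j)
==-injective φ φ-inj i j with i == j in e
... | true = subst (λ z → (φ i == φ z) ≡ true) (==⇒≡ e) (==-refl (φ i))
... | false = ≢⇒==false (λ φi≡φj → ==false⇒≢ e (φ-inj φi≡φj))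

matching-≅ : ∀ {n} {G H : Graph n} → G ≅ H → NonEdgesMatching H → NonEdgesMatching G
matching-≅ {G = G} {H} (π , π-adj) matched x y y′ x≁y x≁y′ =
  permutation-injective π (matched (π ⟨$⟩ʳ x) (π ⟨$⟩ʳ y) (π ⟨$⟩ʳ y′) (transport y x≁y) (transport y′ x≁y′))
  where
  transport : ∀ z → NonAdj G x z ≡ true → NonAdj H (π ⟨$⟩ʳ x) (π ⟨$⟩ʳ z) ≡ true
  transport z = trans (cong₂ (λ a b → not a ∧ not b) (sym (π-adj x z)) (==-injective (π ⟨$⟩ʳ_) (permutation-injective π) x z))

permutation-matching : ∀ {n} (P P′ : Fin n → Bool) → count P ≡ count P′ →
  Σ (Permutation′ n) λ π → ∀ i → P′ (π ⟨$⟩ʳ i) ≡ P i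
permutation-matching {zero} P P′ _ = Perm.id , λ ()
permutation-matching {suc n} P P′ ∣P∣≡∣P′∣ = insert zero j σ , σ-ok
  where
  target : Σ (Fin (suc n)) λ j → P′ j ≡ P zero
  target with P zero in P₀
  ... | true = count-witness {P = P′} (subst (0 <_) ∣P∣≡∣P′∣ (s≤s z≤n))
  ... | false with count-witness {P = λ i → not (P′ i)} some-false
    where
    some-false : 0 < count (λ i → not (P′ i))
    some-false with count (λ i → not (P′ i)) in c
    ... | suc _ = s≤s z≤n
    ... | zero = ⊥-elim (<-irrefl refl (≤-trans (≤-reflexive (trans (sym all) (sym ∣P∣≡∣P′∣))) (count≤n (λ i → P (suc i)))))
      where
      all : count P′ ≡ suc n
      all = trans (sym (+-identityʳ (count P′))) (trans (cong (count P′ +_) (sym c)) (count-not P′))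
  ...   | j , P′j = j , not-true P′j
  j = proj₁ target
  rest : count (λ i → P (suc i)) ≡ count (λ i → P′ (punchIn j i))
  rest = +-cancelˡ-≡ (fromBool (P zero)) _ _ (trans ∣P∣≡∣P′∣ (trans (sum-remove {i = j} (λ i → fromBool (P′ i)))
           (cong (λ b → fromBool b + count (λ i → P′ (punchIn j i))) (proj₂ target))))
  σ = proj₁ (permutation-matching (λ i → P (suc i)) (λ i → P′ (punchIn j i)) rest)
  σ-ok : ∀ i → P′ (insert zero j σ ⟨$⟩ʳ i) ≡ P i
  σ-ok zero = proj₂ target
  σ-ok (suc i) = trans (cong P′ (insert-punchIn zero j σ i)) (proj₂ (permutation-matching (λ i → P (suc i)) (λ i → P′ (punchIn j i)) rest) i)

inClique : ∀ r k → Fin (r + k + 1) → Bool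
inClique r k i = toℕ i <ᵇ suc k

count-inClique : ∀ r k → count (inClique r k) ≡ suc k
count-inClique r k = count-initial-segment (r + k + 1) (suc k) (≤-trans (s≤s (m≤n+m k r)) (≤-reflexive (+-comm 1 (r + k))))

GRKShape⇒≅GRK : ∀ r k (G : Graph (r + k + 1)) → count (Deficient G) ≡ r → GRKShape G → G ≅ GRK r k
GRKShape⇒≅GRK r k G ∣W∣≡r shape = π , π-adj
  where
  ∣V∖W∣ : count (λ i → not (Deficient G i)) ≡ suc k
  ∣V∖W∣ = +-cancelˡ-≡ r _ _ (trans (cong (_+ count (λ i → not (Deficient G i))) (sym ∣W∣≡r))
            (trans (count-not (Deficient G)) (trans (+-assoc r k 1) (cong (r +_) (+-comm k 1)))))
  matched = permutation-matching (λ i → not (Deficient G i)) (inClique r k) (trans ∣V∖W∣ (sym (count-inClique r k)))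
  π = proj₁ matched
  π-adj : ∀ i j → Adj G i j ≡ Adj (GRK r k) (π ⟨$⟩ʳ i) (π ⟨$⟩ʳ j)
  π-adj i j = trans (shape i j) (sym (cong₂ (λ a b → not a ∧ b) (==-injective (π ⟨$⟩ʳ_) (permutation-injective π) i j)
                                          (cong₂ _∨_ (proj₂ matched i) (proj₂ matched j))))

delete : ∀ {n} → Graph (suc n) → Fin (suc n) → Graph n
delete G u = record
  { Adj    = λ i j → Adj G (punchIn u i) (punchIn u j)
  ; sym    = λ i j → Graph.sym G (punchIn u i) (punchIn u j)
  ; irrefl = λ i → irrefl G (punchIn u i)
  }

NonAdj-delete : ∀ {n} (G : Graph (suc n)) u i j → NonAdj (delete G u) i j ≡ NonAdj G (punchIn u i) (punchIn u j)
NonAdj-delete G u i j = cong (λ b → not (Adj G (punchIn u i) (punchIn u j)) ∧ not b)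
                             (sym (==-injective (punchIn u) (λ {a} {b} → punchIn-injective u a b) i j))

matching-delete : ∀ {n} (G : Graph (suc n)) u → NonEdgesMatching G → NonEdgesMatching (delete G u)
matching-delete G u matched x y y′ x≁y x≁y′ = punchIn-injective u y y′
  (matched (punchIn u x) (punchIn u y) (punchIn u y′) (trans (sym (NonAdj-delete G u x y)) x≁y) (trans (sym (NonAdj-delete G u x y′)) x≁y′))

matching-Adj : ∀ {n} (G : Graph n) → NonEdgesMatching G → ∀ x q → NonAdj G x q ≡ true →
  ∀ y → Adj G x y ≡ not (x == y) ∧ not (q == y)
matching-Adj G matched x q x≁q y with x == y in x≡y
... | true = subst (λ z → Adj G x z ≡ false) (==⇒≡ x≡y) (irrefl G x)
... | false with q == y in q≡y
...   | true = subst (λ z → Adj G x z ≡ false) (==⇒≡ q≡y) (NonAdj⇒¬Adj G x≁q)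
...   | false with NonAdj G x y in x≁y
...     | true = ⊥-elim (==false⇒≢ q≡y (matched x q y x≁q x≁y))
...     | false = ¬NonAdj⇒Adj G (==false⇒≢ x≡y) x≁y

¬deficient-Adj : ∀ {n} (G : Graph n) u → Deficient G u ≡ false → ∀ y → Adj G u y ≡ not (u == y)
¬deficient-Adj G u u-full y with u == y in u≡y
... | true = subst (λ z → Adj G u z ≡ false) (==⇒≡ u≡y) (irrefl G u)
... | false = ¬NonAdj⇒Adj G (==false⇒≢ u≡y) (¬deficient⇒¬NonAdj G u-full y)

punchIn-view : ∀ {n} (u k : Fin (suc n)) → k ≡ u ⊎ Σ (Fin n) λ i → k ≡ punchIn u i
punchIn-view u k with u ≟ k
... | yes u≡k = inj₁ (sym u≡k)
... | no u≢k = inj₂ (punchOut u≢k , sym (punchIn-punchOut u≢k))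

insert-self : ∀ {n} (u u′ : Fin (suc n)) (σ : Permutation′ n) → insert u u′ σ ⟨$⟩ʳ u ≡ u′
insert-self u u′ σ with u ≟ u
... | yes _ = refl
... | no u≢u = ⊥-elim (u≢u refl)

partner-of-zero : ∀ {n} (H : Graph (suc (suc n))) → (∀ i → Deficient H i ≡ true) →
  Σ (Fin (suc n)) λ q → NonAdj H zero (suc q) ≡ true
partner-of-zero H W with deficient-witness H (W zero)
... | zero , e = ⊥-elim (t≢f (trans (sym e) (NonAdj-irrefl H zero)))
... | suc q , e = q , e

partner-universal : ∀ {n} (H : Graph (suc (suc n))) → NonEdgesMatching H → ∀ q → NonAdj H zero (suc q) ≡ true →
  Deficient (delete H zero) q ≡ false
partner-universal H matched q 0≁q = anyᵇ-none λ j → lemma j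
  where
  lemma : ∀ j → NonAdj H (suc q) (suc j) ≡ false
  lemma j with NonAdj H (suc q) (suc j) in e
  ... | false = refl
  ... | true with matched (suc q) zero (suc j) (trans (NonAdj-sym H (suc q) zero) 0≁q) e
  ...   | ()

others-deficient : ∀ {n} (H : Graph (suc (suc n))) → NonEdgesMatching H → (∀ i → Deficient H i ≡ true) →
  ∀ q → NonAdj H zero (suc q) ≡ true → ∀ i → i ≢ q → Deficient (delete H zero) i ≡ true
others-deficient H matched W q 0≁q i i≢q with deficient-witness H (W (suc i))
... | zero , e = ⊥-elim (i≢q (Fin.suc-injective (matched zero (suc i) (suc q) (trans (NonAdj-sym H zero (suc i)) e) 0≁q)))
... | suc g , e = anyᵇ-intro {P = NonAdj (delete H zero) i} g e

all-deficient-after-delete : ∀ {n} (H : Graph (suc n)) v → Deficient H v ≡ false → (∀ i → i ≢ v → Deficient H i ≡ true) →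
  ∀ i → Deficient (delete H v) i ≡ true
all-deficient-after-delete H v v-full W i with deficient-witness H (W (punchIn v i) (punchInᵢ≢i v i))
... | g , e with punchIn-view v g
...   | inj₁ refl = ⊥-elim (t≢f (trans (sym (trans (NonAdj-sym H v (punchIn v i)) e)) (¬deficient⇒¬NonAdj H v-full (punchIn v i))))
...   | inj₂ (g′ , refl) = anyᵇ-intro g′ (trans (NonAdj-delete H v i g′) e)

-- Deleting vertex 0 turns its partner into a universal vertex, and deleting a universal vertex leaves
-- every vertex deficient: hence the mutual induction.
all-deficient-≅ : ∀ n (G G′ : Graph n) → NonEdgesMatching G → NonEdgesMatching G′ →
  (∀ i → Deficient G i ≡ true) → (∀ i → Deficient G′ i ≡ true) → G ≅ G′
one-universal-≅ : ∀ n (G G′ : Graph (suc n)) u u′ → NonEdgesMatching G → NonEdgesMatching G′ →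
  Deficient G u ≡ false → Deficient G′ u′ ≡ false →
  (∀ i → i ≢ u → Deficient G i ≡ true) → (∀ i → i ≢ u′ → Deficient G′ i ≡ true) →
  Σ (G ≅ G′) λ iso → proj₁ iso ⟨$⟩ʳ u ≡ u′

all-deficient-≅ zero G G′ _ _ _ _ = Perm.id , λ ()
all-deficient-≅ (suc zero) G G′ _ _ W _ with deficient-witness G (W zero)
... | zero , e = ⊥-elim (t≢f (trans (sym e) (NonAdj-irrefl G zero)))
all-deficient-≅ (suc (suc n)) G G′ matched matched′ W W′ = lift₀ σ , π-adj
  where
  q = proj₁ (partner-of-zero G W)
  q′ = proj₁ (partner-of-zero G′ W′)
  0≁q = proj₂ (partner-of-zero G W)
  0≁q′ = proj₂ (partner-of-zero G′ W′)
  rest = one-universal-≅ n (delete G zero) (delete G′ zero) q q′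
           (matching-delete G zero matched) (matching-delete G′ zero matched′)
           (partner-universal G matched q 0≁q) (partner-universal G′ matched′ q′ 0≁q′)
           (others-deficient G matched W q 0≁q) (others-deficient G′ matched′ W′ q′ 0≁q′)
  σ = proj₁ (proj₁ rest)
  from-zero : ∀ j → Adj G zero (suc j) ≡ Adj G′ zero (suc (σ ⟨$⟩ʳ j))
  from-zero j = trans (matching-Adj G matched zero (suc q) 0≁q (suc j))
    (trans (cong (λ b → true ∧ not b) (trans (sym (==-injective (σ ⟨$⟩ʳ_) (permutation-injective σ) q j))
                                             (cong (λ z → z == (σ ⟨$⟩ʳ j)) (proj₂ rest))))
           (sym (matching-Adj G′ matched′ zero (suc q′) 0≁q′ (suc (σ ⟨$⟩ʳ j)))))
  π-adj : ∀ i j → Adj G i j ≡ Adj G′ (lift₀ σ ⟨$⟩ʳ i) (lift₀ σ ⟨$⟩ʳ j)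
  π-adj zero zero = trans (irrefl G zero) (sym (irrefl G′ zero))
  π-adj zero (suc j) = from-zero j
  π-adj (suc i) zero = trans (Graph.sym G (suc i) zero) (trans (from-zero i) (Graph.sym G′ zero (suc (σ ⟨$⟩ʳ i))))
  π-adj (suc i) (suc j) = proj₂ (proj₁ rest) i j

one-universal-≅ n G G′ u u′ matched matched′ u-full u′-full W W′ = (insert u u′ σ , π-adj) , insert-self u u′ σ
  where
  rest = all-deficient-≅ n (delete G u) (delete G′ u′) (matching-delete G u matched) (matching-delete G′ u′ matched′)
           (all-deficient-after-delete G u u-full W) (all-deficient-after-delete G′ u′ u′-full W′)
  σ = proj₁ rest
  from-u : ∀ i → Adj G u (punchIn u i) ≡ Adj G′ (insert u u′ σ ⟨$⟩ʳ u) (insert u u′ σ ⟨$⟩ʳ punchIn u i)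
  from-u i = trans (¬deficient-Adj G u u-full (punchIn u i))
    (trans (cong not (trans (≢⇒==false (λ e → punchInᵢ≢i u i (sym e))) (sym (≢⇒==false (λ e → punchInᵢ≢i u′ (σ ⟨$⟩ʳ i) (sym e))))))
           (sym (trans (cong₂ (Adj G′) (insert-self u u′ σ) (insert-punchIn u u′ σ i))
                       (¬deficient-Adj G′ u′ u′-full (punchIn u′ (σ ⟨$⟩ʳ i))))))
  π-adj : ∀ i j → Adj G i j ≡ Adj G′ (insert u u′ σ ⟨$⟩ʳ i) (insert u u′ σ ⟨$⟩ʳ j)
  π-adj i j with punchIn-view u i | punchIn-view u j
  ... | inj₁ refl        | inj₁ refl        = trans (irrefl G u) (sym (irrefl G′ (insert u u′ σ ⟨$⟩ʳ u)))
  ... | inj₁ refl        | inj₂ (j′ , refl) = from-u j′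
  ... | inj₂ (i′ , refl) | inj₁ refl        = trans (Graph.sym G (punchIn u i′) u) (trans (from-u i′) (Graph.sym G′ _ _))
  ... | inj₂ (i′ , refl) | inj₂ (j′ , refl) = trans (proj₂ rest i′ j′)
                                                    (sym (cong₂ (Adj G′) (insert-punchIn u u′ σ i′) (insert-punchIn u u′ σ j′)))

-- The model graphs

/2≡⌊/2⌋ : ∀ a → a / 2 ≡ ⌊ a /2⌋
/2≡⌊/2⌋ zero = refl
/2≡⌊/2⌋ (suc zero) = refl
/2≡⌊/2⌋ (suc (suc a)) = trans (m/n≡1+[m∸n]/n {suc (suc a)} {2} (s≤s (s≤s z≤n))) (cong suc (/2≡⌊/2⌋ a))

mate : ℕ → ℕ
mate zero = 1
mate (suc zero) = 0
mate (suc (suc a)) = suc (suc (mate a))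

⌊mate/2⌋ : ∀ a → ⌊ mate a /2⌋ ≡ ⌊ a /2⌋
⌊mate/2⌋ zero = refl
⌊mate/2⌋ (suc zero) = refl
⌊mate/2⌋ (suc (suc a)) = cong suc (⌊mate/2⌋ a)

mate≢ : ∀ a → mate a ≢ a
mate≢ (suc (suc a)) e = mate≢ a (suc-injective (suc-injective e))

same-half⇒mate : ∀ a b → ⌊ a /2⌋ ≡ ⌊ b /2⌋ → a ≢ b → b ≡ mate a
same-half⇒mate zero          zero          _ a≢b = ⊥-elim (a≢b refl)
same-half⇒mate zero          (suc zero)    _ _   = refl
same-half⇒mate (suc zero)    zero          _ _   = refl
same-half⇒mate (suc zero)    (suc zero)    _ a≢b = ⊥-elim (a≢b refl)
same-half⇒mate (suc (suc a)) (suc (suc b)) e a≢b =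
  cong (λ z → suc (suc z)) (same-half⇒mate a b (suc-injective e) (λ a≡b → a≢b (cong (λ z → suc (suc z)) a≡b)))

mate< : ∀ a M → a < M * 2 → mate a < M * 2
mate< zero          (suc M) _ = s≤s (s≤s z≤n)
mate< (suc zero)    (suc M) _ = s≤s z≤n
mate< (suc (suc a)) (suc M) (s≤s (s≤s a<2M)) = s≤s (s≤s (mate< a M a<2M))

mate-even< : ∀ M → M * 2 < mate (M * 2)
mate-even< zero = s≤s z≤n
mate-even< (suc M) = s≤s (s≤s (mate-even< M))

KminusM-NonAdj : ∀ n (x y : Fin n) → NonAdj (KminusM n) x y ≡ true → ⌊ toℕ x /2⌋ ≡ ⌊ toℕ y /2⌋ × x ≢ y
KminusM-NonAdj n x y x≁y =
  trans (sym (/2≡⌊/2⌋ (toℕ x))) (trans (≡ᵇ⇒≡ _ _ (true⇒T ((not-not (∧-trueˡ x≁y))))) (/2≡⌊/2⌋ (toℕ y))) ,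
  NonAdj⇒≢ (KminusM n) x≁y
  where
  not-not : ∀ {b} → not (not b) ≡ true → b ≡ true
  not-not {true} _ = refl

KminusM-NonAdj-intro : ∀ n (x y : Fin n) → ⌊ toℕ x /2⌋ ≡ ⌊ toℕ y /2⌋ → x ≢ y → NonAdj (KminusM n) x y ≡ true
KminusM-NonAdj-intro n x y same x≢y =
  ∧-true (cong not (cong not (T⇒true (≡⇒≡ᵇ _ _ (trans (/2≡⌊/2⌋ (toℕ x)) (trans same (sym (/2≡⌊/2⌋ (toℕ y)))))))))
        (cong not (≢⇒==false x≢y))

KminusM-matching : ∀ n → NonEdgesMatching (KminusM n)
KminusM-matching n x y y′ x≁y x≁y′ with KminusM-NonAdj n x y x≁y | KminusM-NonAdj n x y′ x≁y′
... | same , x≢y | same′ , x≢y′ =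
  toℕ-injective (trans (same-half⇒mate (toℕ x) (toℕ y) same (λ e → x≢y (toℕ-injective e)))
                       (sym (same-half⇒mate (toℕ x) (toℕ y′) same′ (λ e → x≢y′ (toℕ-injective e)))))

KminusM-deficient : ∀ n M (x : Fin n) → toℕ x < M * 2 → M * 2 ≤ n → Deficient (KminusM n) x ≡ true
KminusM-deficient n M x x<2M 2M≤n =
  deficient-intro (KminusM n) {x = x} {y = y}
    (KminusM-NonAdj-intro n x y (trans (sym (⌊mate/2⌋ (toℕ x))) (cong ⌊_/2⌋ (sym toℕy)))
                                (λ x≡y → mate≢ (toℕ x) (trans (sym toℕy) (cong toℕ (sym x≡y)))))
  where
  y : Fin n
  y = fromℕ< (≤-trans (mate< (toℕ x) M x<2M) 2M≤n)
  toℕy : toℕ y ≡ mate (toℕ x)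
  toℕy = toℕ-fromℕ< _

KminusM-last-universal : ∀ n M (x : Fin n) → toℕ x ≡ M * 2 → n ≤ suc (M * 2) → Deficient (KminusM n) x ≡ false
KminusM-last-universal n M x x≡2M n≤ = anyᵇ-none lemma
  where
  lemma : ∀ y → NonAdj (KminusM n) x y ≡ false
  lemma y with NonAdj (KminusM n) x y in e
  ... | false = refl
  ... | true with KminusM-NonAdj n x y e
  ...   | same , x≢y = ⊥-elim (<-irrefl refl (≤-trans (subst (M * 2 <_) (sym y≡mate) (mate-even< M)) (≤-pred (≤-trans (toℕ<n y) n≤))))
    where
    y≡mate : toℕ y ≡ mate (M * 2)
    y≡mate = same-half⇒mate (M * 2) (toℕ y) (trans (cong ⌊_/2⌋ (sym x≡2M)) same) (λ e → x≢y (toℕ-injective (trans x≡2M e)))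

lonely-vertex : ∀ n (S : Fin n → Bool) q → count S ≡ suc (q * 2) →
  Σ (Fin n) λ c → S c ≡ true × (∀ j → S j ≡ true → j ≢ c → ⌊ toℕ j /2⌋ ≢ ⌊ toℕ c /2⌋)
lonely-vertex (suc zero) S q e with S zero in S₀
... | true = zero , S₀ , λ { zero _ j≢c → ⊥-elim (j≢c refl) }
... | false with e
...   | ()
lonely-vertex (suc (suc n)) S q e with S zero in S₀ | S (suc zero) in S₁
... | true | false = zero , S₀ , λ { zero _ j≢c → ⊥-elim (j≢c refl)
                                   ; (suc zero) Sj _ → ⊥-elim (t≢f (trans (sym Sj) S₁))
                                   ; (suc (suc j)) _ _ () }
... | false | true = suc zero , S₁ , λ { (suc zero) _ j≢c → ⊥-elim (j≢c refl)
                                       ; zero Sj _ → ⊥-elim (t≢f (trans (sym Sj) S₀))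
                                       ; (suc (suc j)) _ _ () }
... | false | false with lonely-vertex n (λ i → S (suc (suc i))) q e
...   | c , Sc , lonely = suc (suc c) , Sc ,
        λ { zero Sj _ → ⊥-elim (t≢f (trans (sym Sj) S₀))
          ; (suc zero) Sj _ → ⊥-elim (t≢f (trans (sym Sj) S₁))
          ; (suc (suc j)) Sj j≢c same → lonely j Sj (λ j≡c → j≢c (cong (λ z → suc (suc z)) j≡c)) (suc-injective same) }
lonely-vertex (suc (suc n)) S zero () | true | true
lonely-vertex (suc (suc n)) S (suc q) e | true | true with lonely-vertex n (λ i → S (suc (suc i))) q (suc-injective (suc-injective e))
...   | c , Sc , lonely = suc (suc c) , Sc ,
        λ { zero _ _ () ; (suc zero) _ _ ()
          ; (suc (suc j)) Sj j≢c same → lonely j Sj (λ j≡c → j≢c (cong (λ z → suc (suc z)) j≡c)) (suc-injective same) }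

-- Among the r + 1 surviving vertices, an odd number, some vertex has lost its mate; it sees all the others.
KminusM-stable : ∀ r k → Even r → VertexStable r k (KminusM (r + k + 1))
KminusM-stable r k even F ∣F∣≡k = star-centred-at r k (KminusM (r + k + 1)) F ∣F∣≡k c (not-true Sc) λ y y∉F y≢c →
    cong not (≢⇒≡ᵇ-false λ same → lonely y (cong not y∉F) y≢c
                                     (trans (sym (/2≡⌊/2⌋ (toℕ y))) (trans (sym same) (/2≡⌊/2⌋ (toℕ c)))))
  where
  found = lonely-vertex (r + k + 1) (λ i → not (lookup F i)) (r / 2) (trans (count-outside r k F ∣F∣≡k) (cong suc (even⇒≡ even)))
  c = proj₁ found
  Sc = proj₁ (proj₂ found)
  lonely = proj₂ (proj₂ found)

-- k deletions cannot exhaust the k + 1 clique vertices, and a clique vertex sees everything.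
GRK-stable : ∀ r k → VertexStable r k (GRK r k)
GRK-stable r k F ∣F∣≡k = star-centred-at r k (GRK r k) F ∣F∣≡k c (not-true (∧-trueʳ {inClique r k c} c-ok)) λ y _ y≢c →
    cong₂ _∧_ (cong not (≢⇒==false (λ c≡y → y≢c (sym c≡y)))) (∨-trueˡ (inClique r k y) (∧-trueˡ c-ok))
  where
  Survivor : Fin (r + k + 1) → Bool
  Survivor i = inClique r k i ∧ not (lookup F i)
  some-survivor : 0 < count Survivor
  some-survivor with count Survivor in none
  ... | suc _ = s≤s z≤n
  ... | zero = ⊥-elim (<-irrefl refl k+1≤k)
    where
    open ≤-Reasoning
    k+1≤k : suc k ≤ k
    k+1≤k = begin
      suc k                                                       ≡⟨ count-inClique r k ⟨
      count (inClique r k)                                        ≡⟨ count-∧-split (inClique r k) (lookup F) ⟩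
      count (λ i → inClique r k i ∧ lookup F i) + count Survivor  ≡⟨ cong (count (λ i → inClique r k i ∧ lookup F i) +_) none ⟩
      count (λ i → inClique r k i ∧ lookup F i) + 0               ≡⟨ +-identityʳ _ ⟩
      count (λ i → inClique r k i ∧ lookup F i)                   ≤⟨ count-mono (λ i e → ∧-trueʳ {inClique r k i} e) ⟩
      count (lookup F)                                            ≡⟨ count-lookup F ⟨
      ∣ F ∣                                                       ≡⟨ ∣F∣≡k ⟩
      k                                                           ∎
  c = proj₁ (count-witness {P = Survivor} some-survivor)
  c-ok = proj₂ (count-witness {P = Survivor} some-survivor)

sum-nonDegree-GRK : ∀ r k → sum (nonDegree (GRK r k)) ≡ r * (r ∸ 1)
sum-nonDegree-GRK r k = trans (sum-cong-≗ nonDegree-x)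
  (trans (sum-indicator (λ x → not (inClique r k x)) (r ∸ 1)) (cong (_* (r ∸ 1)) ∣outside∣))
  where
  ∣outside∣ : count (λ i → not (inClique r k i)) ≡ r
  ∣outside∣ = +-cancelˡ-≡ (suc k) _ _ (trans (cong (_+ count (λ i → not (inClique r k i))) (sym (count-inClique r k)))
                (trans (count-not (inClique r k)) (trans (+-comm (r + k) 1) (cong suc (+-comm r k)))))
  clique : ∀ a → (not (not a ∧ true) ∧ not a) ≡ false
  clique true  = refl
  clique false = refl
  independent : ∀ a b → (not (not a ∧ b) ∧ not a) ≡ (not b ∧ not a)
  independent true  b = trans (∧-zeroʳ (not (false ∧ b))) (sym (∧-zeroʳ (not b)))
  independent false b = refl
  nonDegree-x : ∀ x → nonDegree (GRK r k) x ≡ fromBool (not (inClique r k x)) * (r ∸ 1)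
  nonDegree-x x with inClique r k x in x-in
  ... | true = count-false (λ j → clique (x == j))
  ... | false = begin
      count (λ j → not (not (x == j) ∧ inClique r k j) ∧ not (x == j))   ≡⟨ count-cong (λ j → independent (x == j) (inClique r k j)) ⟩
      count (λ j → not (inClique r k j) ∧ not (x == j))   ≡⟨ cong (_∸ 1) (count-remove {P = λ i → not (inClique r k i)} x (cong not x-in)) ⟨
      count (λ i → not (inClique r k i)) ∸ 1              ≡⟨ cong (_∸ 1) ∣outside∣ ⟩
      r ∸ 1                                              ≡⟨ +-identityʳ (r ∸ 1) ⟨
      1 * (r ∸ 1)                                        ∎
    where open ≡-Reasoning

-- The vertex of index k + 1 has the two non-neighbours k + 2 and k + 3.
GRK-¬matching : ∀ r k → 3 ≤ r → ¬ NonEdgesMatching (GRK r k)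
GRK-¬matching r k r≥3 matched = 1≢2 (+-cancelˡ-≡ (suc k) 1 2
  (trans (sym (toℕ-vertex 1 (s≤s z≤n))) (trans (cong toℕ same) (toℕ-vertex 2 (s≤s (s≤s z≤n))))))
  where
  1≢2 : 1 ≢ 2
  1≢2 ()
  vertex : ∀ i → i ≤ 2 → Fin (r + k + 1)
  vertex i i≤2 = fromℕ< (≤-trans (s≤s (≤-trans (+-monoʳ-≤ (suc k) i≤2) (≤-reflexive (+-comm (suc k) 2))))
                                 (≤-trans (+-monoˡ-≤ (suc k) r≥3) (≤-reflexive (trans (cong (r +_) (+-comm 1 k)) (sym (+-assoc r k 1))))))
  toℕ-vertex : ∀ i i≤2 → toℕ (vertex i i≤2) ≡ suc k + i
  toℕ-vertex i i≤2 = toℕ-fromℕ< _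
  outside : ∀ i i≤2 → inClique r k (vertex i i≤2) ≡ false
  outside i i≤2 with inClique r k (vertex i i≤2) in e
  ... | false = refl
  ... | true = ⊥-elim (<-irrefl refl (≤-trans (s≤s (≤-trans (m≤m+n (suc k) i) (≤-reflexive (sym (toℕ-vertex i i≤2)))))
                                               (<ᵇ⇒< _ _ (true⇒T e))))
  independent : ∀ i j (i≤2 : i ≤ 2) (j≤2 : j ≤ 2) → i ≢ j → NonAdj (GRK r k) (vertex i i≤2) (vertex j j≤2) ≡ true
  independent i j i≤2 j≤2 i≢j rewrite outside i i≤2 | outside j j≤2
    | ≢⇒≡ᵇ-false {toℕ (vertex i i≤2)} {toℕ (vertex j j≤2)}
        (λ e → i≢j (+-cancelˡ-≡ (suc k) i j (trans (sym (toℕ-vertex i i≤2)) (trans e (toℕ-vertex j j≤2))))) = refl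
  same : vertex 1 (s≤s z≤n) ≡ vertex 2 (s≤s (s≤s z≤n))
  same = matched (vertex 0 z≤n) (vertex 1 (s≤s z≤n)) (vertex 2 (s≤s (s≤s z≤n)))
           (independent 0 1 z≤n (s≤s z≤n) (λ ())) (independent 0 2 z≤n (s≤s (s≤s z≤n)) (λ ()))

sum-nonDegree-KminusM-even : ∀ M → sum (nonDegree (KminusM (M * 2))) ≡ M * 2
sum-nonDegree-KminusM-even M = trans (sum-nonDegree-matching (KminusM (M * 2)) (KminusM-matching (M * 2)))
  (trans (count-cong (λ x → KminusM-deficient (M * 2) M x (toℕ<n x) ≤-refl)) (count-true (M * 2)))

sum-nonDegree-KminusM-odd : ∀ M → sum (nonDegree (KminusM (suc (M * 2)))) ≡ M * 2
sum-nonDegree-KminusM-odd M = begin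
    sum (nonDegree (KminusM (suc (M * 2))))                 ≡⟨ sum-nonDegree-matching (KminusM (suc (M * 2))) (KminusM-matching (suc (M * 2))) ⟩
    count (Deficient (KminusM (suc (M * 2))))              ≡⟨ count-cong deficient⇔below ⟩
    count {suc (M * 2)} (λ x → toℕ x <ᵇ M * 2)             ≡⟨ count-initial-segment (suc (M * 2)) (M * 2) (n≤1+n _) ⟩
    M * 2                                                  ∎
  where
  open ≡-Reasoning
  deficient⇔below : ∀ x → Deficient (KminusM (suc (M * 2))) x ≡ (toℕ x <ᵇ M * 2)
  deficient⇔below x with toℕ x <? M * 2
  ... | yes x<2M = trans (KminusM-deficient (suc (M * 2)) M x x<2M (n≤1+n _)) (sym (<⇒<ᵇ-true x<2M))
  ... | no x≮2M = trans (KminusM-last-universal (suc (M * 2)) M x x≡2M ≤-refl) (sym (≮⇒<ᵇ-false x≮2M))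
    where
    x≡2M : toℕ x ≡ M * 2
    x≡2M = ≤-antisym (≤-pred (toℕ<n x)) (≮⇒≥ x≮2M)
    ≮⇒<ᵇ-false : ∀ {a b} → ¬ a < b → (a <ᵇ b) ≡ false
    ≮⇒<ᵇ-false {a} {b} a≮b with a <ᵇ b in e
    ... | false = refl
    ... | true = ⊥-elim (a≮b (<ᵇ⇒< a b (true⇒T e)))

matching-≅-KminusM-even : ∀ N M → N ≡ M * 2 → (G : Graph N) → NonEdgesMatching G → count (Deficient G) ≡ N → G ≅ KminusM N
matching-≅-KminusM-even N M N≡2M G matched ∣W∣≡N = all-deficient-≅ N G (KminusM N) matched (KminusM-matching N) (count-all ∣W∣≡N)
  (λ x → KminusM-deficient N M x (subst (toℕ x <_) N≡2M (toℕ<n x)) (≤-reflexive (sym N≡2M)))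

matching-≅-KminusM-odd : ∀ N M → N ≡ suc (M * 2) → (G : Graph N) → NonEdgesMatching G → count (Deficient G) ≡ M * 2 → G ≅ KminusM N
matching-≅-KminusM-odd (suc n) M N≡ G matched ∣W∣≡2M =
  proj₁ (one-universal-≅ n G (KminusM (suc n)) u last matched (KminusM-matching (suc n))
          (proj₁ (proj₂ universal)) (KminusM-last-universal (suc n) M last toℕ-last (≤-reflexive N≡))
          (proj₂ (proj₂ universal)) W′)
  where
  one-universal : count (λ i → not (Deficient G i)) ≡ 1
  one-universal = +-cancelˡ-≡ (M * 2) _ _ (trans (cong (_+ count (λ i → not (Deficient G i))) (sym ∣W∣≡2M))
                    (trans (count-not (Deficient G)) (trans N≡ (+-comm 1 (M * 2)))))
  universal = count-all-but-one {P = Deficient G} one-universal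
  u = proj₁ universal
  last : Fin (suc n)
  last = fromℕ< (≤-reflexive (sym N≡))
  toℕ-last : toℕ last ≡ M * 2
  toℕ-last = toℕ-fromℕ< _
  W′ : ∀ i → i ≢ last → Deficient (KminusM (suc n)) i ≡ true
  W′ i i≢last = KminusM-deficient (suc n) M i (≤∧≢⇒< (≤-pred (subst (toℕ i <_) N≡ (toℕ<n i))) (λ e → i≢last (toℕ-injective (trans e (sym toℕ-last)))))
                  (≤-trans (n≤1+n _) (≤-reflexive (sym N≡)))

-- The extremal regimes

-- By the handshake identity, a bound B on 2|E| amounts to a bound X on the total non-degree.

module Budget (r k B X : ℕ) (budget : B + X + (r + k + 1) ≡ (r + k + 1) * (r + k + 1)) where

  private
    trade : ∀ (G : Graph (r + k + 1)) → 2 * edges G + sum (nonDegree G) ≡ B + X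
    trade G = +-cancelʳ-≡ (r + k + 1) _ _ (trans (handshake G) (sym budget))

  lower-bound : (∀ (G : Graph (r + k + 1)) → VertexStable r k G → sum (nonDegree G) ≤ X) → LowerBound r k B
  lower-bound H≤X G stable = +-cancelʳ-≤ X B (2 * edges G)
    (≤-trans (≤-reflexive (sym (trade G))) (+-monoʳ-≤ (2 * edges G) (H≤X G stable)))

  extremal⇒tight : ∀ (G : Graph (r + k + 1)) → Extremal r k B G → sum (nonDegree G) ≡ X
  extremal⇒tight G (_ , 2e≡B) = +-cancelˡ-≡ B _ _ (trans (cong (_+ sum (nonDegree G)) (sym 2e≡B)) (trade G))

  tight⇒extremal : ∀ (G : Graph (r + k + 1)) → VertexStable r k G → sum (nonDegree G) ≡ X → Extremal r k B G
  tight⇒extremal G stable H≡X = stable , +-cancelʳ-≡ X _ _ (trans (cong (2 * edges G +_) (sym H≡X)) (trade G))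

square-parity : ∀ n → Σ ℕ λ d → n * n ≡ n + d * 2
square-parity zero = 0 , refl
square-parity (suc n) with square-parity n
... | d , n²≡ = n + d , trans (expand n) (trans (cong (λ z → suc n + n + z) n²≡) (regroup n d))
  where
  expand : ∀ n → suc n * suc n ≡ suc n + n + n * n
  expand = solve-∀
  regroup : ∀ n d → suc n + n + (n + d * 2) ≡ suc n + (n + d) * 2
  regroup = solve-∀

sum-nonDegree-even : ∀ {n} (G : Graph n) → Σ ℕ λ c → sum (nonDegree G) ≡ c * 2
sum-nonDegree-even {n} G with square-parity n
... | d , n²≡ = d ∸ edges G , sym (begin
    (d ∸ edges G) * 2                                  ≡⟨ *-distribʳ-∸ 2 d (edges G) ⟩
    d * 2 ∸ edges G * 2                                ≡⟨ cong (_∸ edges G * 2) (sym 2e+H≡2d) ⟩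
    edges G * 2 + sum (nonDegree G) ∸ edges G * 2      ≡⟨ m+n∸m≡n (edges G * 2) _ ⟩
    sum (nonDegree G)                                  ∎)
  where
  open ≡-Reasoning
  2e+H≡2d : edges G * 2 + sum (nonDegree G) ≡ d * 2
  2e+H≡2d = +-cancelʳ-≡ n _ _ (trans (cong (λ e → e + sum (nonDegree G) + n) (*-comm (edges G) 2))
                                (trans (handshake G) (trans n²≡ (+-comm n (d * 2)))))

^2≡* : ∀ m → m ^ 2 ≡ m * m
^2≡* m = cong (m *_) (*-identityʳ m)

even≤odd⇒≤ : ∀ {H M} → H ≤ suc (M * 2) → Σ ℕ (λ c → H ≡ c * 2) → H ≤ M * 2
even≤odd⇒≤ {M = M} H≤ (c , H≡2c) = ≤-pred (≤∧≢⇒< H≤ (λ H≡ → even≢odd′ c M (trans (sym H≡2c) H≡)))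


-- With r = a + 1 the terms r ∸ 1 and r * (r ∸ 1) = a + a * a compute.

module Regimes (a k : ℕ) (2≤a : 2 ≤ a) where

  r N X : ℕ
  r = suc a
  N = r + k + 1
  X = r * (r ∸ 1)

  r≥3 : 3 ≤ r
  r≥3 = s≤s 2≤a

  budget-GRK : boundGRK r k + X + N ≡ N * N
  budget-GRK = expanded a k
    where
    expanded : ∀ a k → (k + 1) * (2 * suc a + k) + suc a * a + (suc a + k + 1) ≡ (suc a + k + 1) * (suc a + k + 1)
    expanded = solve-∀

  open Budget r k (boundGRK r k) X budget-GRK

  GRK-extremal : Extremal r k (boundGRK r k) (GRK r k)
  GRK-extremal = tight⇒extremal (GRK r k) (GRK-stable r k) (sum-nonDegree-GRK r k)

  GRK≇KminusM : ¬ (GRK r k ≅ KminusM N)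
  GRK≇KminusM iso = GRK-¬matching r k r≥3 (matching-≅ {G = GRK r k} {H = KminusM N} iso (KminusM-matching N))

  X-even : Even r → X ≡ (r / 2 * a) * 2
  X-even even = trans (cong (_* a) (even⇒≡ {r} even)) (regroup (r / 2) a)
    where
    regroup : ∀ c a → c * 2 * a ≡ c * a * 2
    regroup = solve-∀

  a²≥2 : 2 ≤ a * a
  a²≥2 = *-mono-≤ (≤-trans (s≤s z≤n) 2≤a) 2≤a

  r<X : r < X
  r<X = ≤-trans (≤-reflexive (+-comm 2 a)) (+-monoʳ-≤ a a²≥2)

  matching-nonDegree≤N : ∀ {G : Graph N} → sum (nonDegree G) ≡ count (Deficient G) → sum (nonDegree G) ≤ N
  matching-nonDegree≤N {G} H≡w = ≤-trans (≤-reflexive H≡w) (count≤n (Deficient G))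

  N<X : k < (r ∸ 1) ^ 2 ∸ 2 → N < X
  N<X k< = ≤-trans (≤-reflexive (regroup a k)) (+-monoʳ-≤ a (k<x∸2⇒3+k≤x (a * a) (subst (λ x → k < x ∸ 2) (^2≡* a) k<)))
    where
    regroup : ∀ a k → suc (suc a + k + 1) ≡ a + (3 + k)
    regroup = solve-∀
    k<x∸2⇒3+k≤x : ∀ x → k < x ∸ 2 → 3 + k ≤ x
    k<x∸2⇒3+k≤x (suc (suc x)) k< = s≤s (s≤s k<)

  spread-tight⇒≅GRK : ∀ {G : Graph N} → (sum (nonDegree G) ≡ X → count (Deficient G) ≡ r × GRKShape G) →
    sum (nonDegree G) ≡ X → G ≅ GRK r k
  spread-tight⇒≅GRK {G} tight H≡X = GRKShape⇒≅GRK r k G (proj₁ (tight H≡X)) (proj₂ (tight H≡X))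

  odd-or-small-matching : (Odd r ⊎ (Even r × k < (r ∸ 1) ^ 2 ∸ 2)) → ∀ {G : Graph N} →
    sum (nonDegree G) ≡ count (Deficient G) → (Odd r → count (Deficient G) ≤ r) → sum (nonDegree G) < X
  odd-or-small-matching (inj₁ odd) H≡w w≤r = ≤-<-trans (≤-trans (≤-reflexive H≡w) (w≤r odd)) r<X
  odd-or-small-matching (inj₂ (_ , k<)) {G} H≡w _ = ≤-<-trans (matching-nonDegree≤N {G} H≡w) (N<X k<)

  odd-or-small : (Odd r ⊎ (Even r × k < (r ∸ 1) ^ 2 ∸ 2)) →
    LowerBound r k (boundGRK r k) × SoleExtremal r k (boundGRK r k) (GRK r k)
  odd-or-small hyp = lower-bound H≤X , GRK-extremal , sole
    where
    H≤X : ∀ (G : Graph N) → VertexStable r k G → sum (nonDegree G) ≤ X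
    H≤X G stable with structure G r≥3 stable
    ... | spread H≤X _ = H≤X
    ... | matching _ H≡w w≤r = <⇒≤ (odd-or-small-matching hyp {G} H≡w w≤r)
    sole : ∀ G → Extremal r k (boundGRK r k) G → G ≅ GRK r k
    sole G extremal with structure G r≥3 (proj₁ extremal) | extremal⇒tight G extremal
    ... | spread _ tight | H≡X = spread-tight⇒≅GRK {G} tight H≡X
    ... | matching _ H≡w w≤r | H≡X = ⊥-elim (<-irrefl H≡X (odd-or-small-matching hyp {G} H≡w w≤r))

  critical : (Even r × k ≡ (r ∸ 1) ^ 2 ∸ 2) →
    LowerBound r k (boundGRK r k) × TwoExtremal r k (boundGRK r k) (GRK r k) (KminusM N)
  critical (even , k≡) = lower-bound H≤X , GRK-extremal , KminusM-extremal , GRK≇KminusM , classify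
    where
    N≡X : N ≡ X
    N≡X = trans (regroup a k) (cong (a +_) (trans (cong (_+ 2) (trans k≡ (cong (_∸ 2) (^2≡* a)))) (m∸n+n≡m a²≥2)))
      where
      regroup : ∀ a k → suc a + k + 1 ≡ a + (k + 2)
      regroup = solve-∀
    M = r / 2 * a
    N≡2M : N ≡ M * 2
    N≡2M = trans N≡X (X-even even)
    H≤X : ∀ (G : Graph N) → VertexStable r k G → sum (nonDegree G) ≤ X
    H≤X G stable with structure G r≥3 stable
    ... | spread H≤X _ = H≤X
    ... | matching _ H≡w _ = ≤-trans (matching-nonDegree≤N {G} H≡w) (≤-reflexive N≡X)
    KminusM-extremal : Extremal r k (boundGRK r k) (KminusM N)
    KminusM-extremal = tight⇒extremal (KminusM N) (KminusM-stable r k even)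
      (trans (subst (λ n → sum (nonDegree (KminusM n)) ≡ n) (sym N≡2M) (sum-nonDegree-KminusM-even M)) N≡X)
    classify : ∀ G → Extremal r k (boundGRK r k) G → G ≅ GRK r k ⊎ G ≅ KminusM N
    classify G extremal with structure G r≥3 (proj₁ extremal) | extremal⇒tight G extremal
    ... | spread _ tight | H≡X = inj₁ (spread-tight⇒≅GRK {G} tight H≡X)
    ... | matching matched H≡w _ | H≡X = inj₂ (matching-≅-KminusM-even N M N≡2M G matched (trans (sym H≡w) (trans H≡X (sym N≡X))))

  critical+1 : (Even r × k ≡ (r ∸ 1) ^ 2 ∸ 1) →
    LowerBound r k (boundGRK r k) × TwoExtremal r k (boundGRK r k) (GRK r k) (KminusM N)
  critical+1 (even , k≡) = lower-bound H≤X , GRK-extremal , KminusM-extremal , GRK≇KminusM , classify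
    where
    M = r / 2 * a
    N≡1+2M : N ≡ suc (M * 2)
    N≡1+2M = trans (regroup a k) (cong suc (trans (cong (a +_) (trans (cong (_+ 1) (trans k≡ (cong (_∸ 1) (^2≡* a))))
                                                                      (m∸n+n≡m (≤-trans (s≤s z≤n) a²≥2))))
                                                  (X-even even)))
      where
      regroup : ∀ a k → suc a + k + 1 ≡ suc (a + (k + 1))
      regroup = solve-∀
    -- H is even (handshake) and at most N = X + 1, hence at most X.
    H≤X : ∀ (G : Graph N) → VertexStable r k G → sum (nonDegree G) ≤ X
    H≤X G stable with structure G r≥3 stable
    ... | spread H≤X _ = H≤X
    ... | matching _ H≡w _ = ≤-trans (even≤odd⇒≤ {M = M} (≤-trans (matching-nonDegree≤N {G} H≡w) (≤-reflexive N≡1+2M)) (sum-nonDegree-even G))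
                                     (≤-reflexive (sym (X-even even)))
    KminusM-extremal : Extremal r k (boundGRK r k) (KminusM N)
    KminusM-extremal = tight⇒extremal (KminusM N) (KminusM-stable r k even)
      (trans (subst (λ n → sum (nonDegree (KminusM n)) ≡ M * 2) (sym N≡1+2M) (sum-nonDegree-KminusM-odd M)) (sym (X-even even)))
    classify : ∀ G → Extremal r k (boundGRK r k) G → G ≅ GRK r k ⊎ G ≅ KminusM N
    classify G extremal with structure G r≥3 (proj₁ extremal) | extremal⇒tight G extremal
    ... | spread _ tight | H≡X = inj₁ (spread-tight⇒≅GRK {G} tight H≡X)
    ... | matching matched H≡w _ | H≡X = inj₂ (matching-≅-KminusM-odd N M N≡1+2M G matched (trans (sym H≡w) (trans H≡X (X-even even))))

  a²≤k₀+1 : ∀ k₀ → IsK₀ r k₀ → a * a ≤ k₀ + 1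
  a²≤k₀+1 k₀ (_ , k₀> , _) = x∸2<y⇒x≤y+1 (a * a) (subst (λ x → x ∸ 2 < k₀) (^2≡* a) k₀>)
    where
    x∸2<y⇒x≤y+1 : ∀ x → x ∸ 2 < k₀ → x ≤ k₀ + 1
    x∸2<y⇒x≤y+1 zero _ = z≤n
    x∸2<y⇒x≤y+1 (suc zero) _ = ≤-trans (s≤s z≤n) (≤-reflexive (+-comm 1 k₀))
    x∸2<y⇒x≤y+1 (suc (suc x)) x< = ≤-trans (s≤s x<) (≤-reflexive (+-comm 1 k₀))

  budget-odd : (r + k) ^ 2 ∸ 1 + N + N ≡ N * N
  budget-odd = expanded (a + k)
    where
    expanded : ∀ m → m * 1 + m * suc (m * 1) + (suc m + 1) + (suc m + 1) ≡ (suc m + 1) * (suc m + 1)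
    expanded = solve-∀

  budget-even : (r + k) ^ 2 + (r + k) + N ≡ N * N
  budget-even = trans (cong (λ s → s + (r + k) + N) (^2≡* (r + k))) (expanded a k)
    where
    expanded : ∀ x y → (suc x + y) * (suc x + y) + (suc x + y) + (suc x + y + 1) ≡ (suc x + y + 1) * (suc x + y + 1)
    expanded = solve-∀

  large-odd : ∀ k₀ → IsK₀ r k₀ → Even r → Odd k → k₀ ≤ k →
    LowerBound r k ((r + k) ^ 2 ∸ 1) × SoleExtremal r k ((r + k) ^ 2 ∸ 1) (KminusM N)
  large-odd k₀ isK₀ even odd k₀≤k = Large.lower-bound H≤N , KminusM-extremal , sole
    where
    module Large = Budget r k ((r + k) ^ 2 ∸ 1) N budget-odd
    M = r / 2 + k / 2 + 1
    N≡2M : N ≡ M * 2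
    N≡2M = trans (cong₂ (λ x y → x + y + 1) (even⇒≡ {r} even) (odd⇒≡ odd)) (regroup (r / 2) (k / 2))
      where
      regroup : ∀ c d → c * 2 + suc (d * 2) + 1 ≡ (c + d + 1) * 2
      regroup = solve-∀
    X<N : X < N
    X<N = s≤s (≤-trans (+-monoʳ-≤ a (≤-trans (a²≤k₀+1 k₀ isK₀) (+-monoˡ-≤ 1 k₀≤k))) (≤-reflexive (sym (+-assoc a k 1))))
    H≤N : ∀ (G : Graph N) → VertexStable r k G → sum (nonDegree G) ≤ N
    H≤N G stable with structure G r≥3 stable
    ... | spread H≤X _ = ≤-trans H≤X (<⇒≤ X<N)
    ... | matching _ H≡w _ = matching-nonDegree≤N {G} H≡w
    KminusM-extremal : Extremal r k ((r + k) ^ 2 ∸ 1) (KminusM N)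
    KminusM-extremal = Large.tight⇒extremal (KminusM N) (KminusM-stable r k even)
      (subst (λ n → sum (nonDegree (KminusM n)) ≡ n) (sym N≡2M) (sum-nonDegree-KminusM-even M))
    sole : ∀ G → Extremal r k ((r + k) ^ 2 ∸ 1) G → G ≅ KminusM N
    sole G extremal with structure G r≥3 (proj₁ extremal) | Large.extremal⇒tight G extremal
    ... | spread H≤X _ | H≡N = ⊥-elim (<-irrefl refl (≤-<-trans (≤-trans (≤-reflexive (sym H≡N)) H≤X) X<N))
    ... | matching matched H≡w _ | H≡N = matching-≅-KminusM-even N M N≡2M G matched (trans (sym H≡w) H≡N)

  large-even : ∀ k₀ → IsK₀ r k₀ → Even r → Even k → k₀ ≤ k →
    LowerBound r k ((r + k) ^ 2) × SoleExtremal r k ((r + k) ^ 2) (KminusM N)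
  large-even k₀ isK₀ even even′ k₀≤k = Large.lower-bound H≤r+k , KminusM-extremal , sole
    where
    module Large = Budget r k ((r + k) ^ 2) (r + k) budget-even
    M = r / 2 + k / 2
    r+k≡2M : r + k ≡ M * 2
    r+k≡2M = trans (cong₂ _+_ (even⇒≡ {r} even) (even⇒≡ even′)) (sym (*-distribʳ-+ 2 (r / 2) (k / 2)))
    N≡1+2M : N ≡ suc (M * 2)
    N≡1+2M = trans (+-comm (r + k) 1) (cong suc r+k≡2M)
    -- k₀ is odd and k even, so k₀ < k.
    a²≤k : a * a ≤ k
    a²≤k = ≤-trans (a²≤k₀+1 k₀ isK₀) (≤-trans (≤-reflexive (+-comm k₀ 1))
             (≤∧≢⇒< k₀≤k (λ k₀≡k → 0≢1 (trans (sym even′) (trans (cong (_% 2) (sym k₀≡k)) (proj₁ isK₀))))))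
      where
      0≢1 : 0 ≢ 1
      0≢1 ()
    X<r+k : X < r + k
    X<r+k = s≤s (+-monoʳ-≤ a a²≤k)
    H≤r+k : ∀ (G : Graph N) → VertexStable r k G → sum (nonDegree G) ≤ r + k
    H≤r+k G stable with structure G r≥3 stable
    ... | spread H≤X _ = ≤-trans H≤X (<⇒≤ X<r+k)
    ... | matching _ H≡w _ = ≤-trans (even≤odd⇒≤ {M = M} (≤-trans (matching-nonDegree≤N {G} H≡w) (≤-reflexive N≡1+2M)) (sum-nonDegree-even G))
                                     (≤-reflexive (sym r+k≡2M))
    KminusM-extremal : Extremal r k ((r + k) ^ 2) (KminusM N)
    KminusM-extremal = Large.tight⇒extremal (KminusM N) (KminusM-stable r k even)
      (trans (subst (λ n → sum (nonDegree (KminusM n)) ≡ M * 2) (sym N≡1+2M) (sum-nonDegree-KminusM-odd M)) (sym r+k≡2M))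
    sole : ∀ G → Extremal r k ((r + k) ^ 2) G → G ≅ KminusM N
    sole G extremal with structure G r≥3 (proj₁ extremal) | Large.extremal⇒tight G extremal
    ... | spread H≤X _ | H≡ = ⊥-elim (<-irrefl refl (≤-<-trans (≤-trans (≤-reflexive (sym H≡)) H≤X) X<r+k))
    ... | matching matched H≡w _ | H≡ = matching-≅-KminusM-odd N M N≡1+2M G matched (trans (sym H≡w) (trans H≡ r+k≡2M))

theorem1 : ∀ (r k : ℕ) → 3 ≤ r →
    -- (1)
    ((Odd r ⊎ (Even r × k < (r ∸ 1) ^ 2 ∸ 2)) →
       LowerBound r k (boundGRK r k) × SoleExtremal r k (boundGRK r k) (GRK r k))
  × -- (2a)
    ((Even r × k ≡ (r ∸ 1) ^ 2 ∸ 2) →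
       LowerBound r k (boundGRK r k) ×
       TwoExtremal r k (boundGRK r k) (GRK r k) (KminusM (r + k + 1)))
  × -- (2b)
    ((Even r × k ≡ (r ∸ 1) ^ 2 ∸ 1) →
       LowerBound r k (boundGRK r k) ×
       TwoExtremal r k (boundGRK r k) (GRK r k) (KminusM (r + k + 1)))
  × -- (3)
    (∀ k₀ → IsK₀ r k₀ → Even r → Odd k → k₀ ≤ k →
       LowerBound r k ((r + k) ^ 2 ∸ 1) ×
       SoleExtremal r k ((r + k) ^ 2 ∸ 1) (KminusM (r + k + 1)))
  × -- (4)
    (∀ k₀ → IsK₀ r k₀ → Even r → Even k → k₀ ≤ k →
       LowerBound r k ((r + k) ^ 2) ×
       SoleExtremal r k ((r + k) ^ 2) (KminusM (r + k + 1)))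
theorem1 (suc a) k (s≤s 2≤a) = odd-or-small , critical , critical+1 , large-odd , large-even
  where open Regimes a k 2≤a
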